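{- For all integers $n\ge 0$ and all integers $k\ge j\ge 0$, \[ a_{3(k-j)+5,\;3k+1}(3n+2)\equiv 0 \pmod 3. \]
   Context: For positive integers $r,s$, $a_{r,s}(n)$ denotes the number of multicolored partitions of $n$ in which each even part may appear in one of $r$ colors and each odd part may appear in one of $s$ colors (copies of the same part size in different colors are distinct), with $a_{r,s}(0)=1$. Equivalently, for $|q|<1$, $\sum_{n\ge0}a_{r,s}(n)q^n = f_2^{s-r}/f_1^{s}$, where $f_m=\prod_{i\ge1}(1-q^{mi})$. -}

module Defs where

open import Data.Nat using (ℕ; zero; suc; _+_; _*_; _∸_; _≤ᵇ_)
open import Data.Nat.DivMod using (_%_)
open import Data.Bool using (if_then_else_)
open import Data.List using (List; []; _∷_; concatMap; replicate; upTo; map)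
open import Data.Nat.ListAction using (sum)

-- A multicolored partition is a multiset of "colored parts" (size, color).
-- A "kind" is a pair (part size, color); we list each kind by its size.
-- countMultisets ws n = number of multisets of kinds from the list ws
-- (each list entry a distinct kind, with the given positive size) whose
-- sizes sum to n: for the head kind choose its multiplicity m = 0..n.
countMultisets : List ℕ → ℕ → ℕ
countMultisets []       n = if n Data.Nat.≡ᵇ 0 then 1 else 0
countMultisets (w ∷ ws) n =
  sum (map (λ m → if (m * w) ≤ᵇ n then countMultisets ws (n ∸ m * w) else 0)
           (upTo (suc n)))

colors : ℕ → ℕ → ℕ → ℕ
colors r s i = if (i % 2) Data.Nat.≡ᵇ 0 then r else s

kinds : ℕ → ℕ → ℕ → List ℕ
kinds r s n = concatMap (λ i → replicate (colors r s (suc i)) (suc i)) (upTo n)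

a : ℕ → ℕ → ℕ → ℕ
a r s n = countMultisets (kinds r s n) n

-- Work in ℤ₃[[q]], truncating at degree D = 3n + 2. With r = 3t + 2 and s = 3u + 1 the
-- generating series C of a_{r,s} satisfies C · ∏_w (1 - q^w)^{c(w)} = 1, where c(w) is r or s
-- by parity. Since (1 - x)³ = 1 - x³ in characteristic 3, the product is V₁ · U with
-- V₁ ∈ ℤ₃[[q³]] and U = (q;q)∞ (q²;q²)∞. Gauss's identity Θ = ∑_k (-1)^k q^{k²} = (q;q²)∞² (q²;q²)∞
-- gives U · Θ = (q;q)∞³ ∈ ℤ₃[[q³]], so C · V = Θ with V a unit of ℤ₃[[q³]]. Multiplication by
-- V does not mix residue classes of exponents mod 3, and no square is ≡ 2 (mod 3), so C has no
-- terms of degree ≡ 2 (mod 3) either. Gauss's identity comes from its finite form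
-- ∑_m (-1)^{m-N} q^{(m-N)²} [2N choose m]_{q²} = (q;q²)_N², proved by induction on N from the two
-- q-Pascal recurrences.

module Submission where

open import Defs
open import Data.Nat
  using ( ℕ; zero; suc; _+_; _*_; _∸_; _≤_; _<_; _≰_; _≤ᵇ_; _≤?_; z≤n; s≤s; NonZero; >-nonZero⁻¹)
open import Data.Nat.Divisibility using (_∣_; divides)
open import Data.Nat.ListAction using (sum)
open import Data.Bool using (true; false; if_then_else_)
open import Data.List using (List; []; _∷_; map; applyUpTo)
open import Data.Product using (_×_; _,_; proj₁; proj₂)
open import Data.Sum using (inj₁; inj₂)
open import Data.Maybe using (Maybe; just; nothing)
open import Function using (_∘_; id)
open import Algebra.Bundles using (CommutativeRing)
open import Algebra.Structures using (IsCommutativeRing)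
import Algebra.Properties.Group
open import Algebra.Solver.Ring.AlmostCommutativeRing using (fromCommutativeRing; _-Raw-AlmostCommutative⟶_)
import Algebra.Solver.Ring.Simple as SimpleSolver
import Algebra.Solver.Ring as RingSolver
open import Relation.Binary.Bundles using (Setoid)
open import Relation.Binary.Definitions using (DecidableEquality)
import Relation.Binary.Reasoning.Setoid as SetoidReasoning
open import Relation.Binary.PropositionalEquality
open import Relation.Nullary using (Dec; yes; no; ¬_; ¬?; contradiction)
open import Relation.Nullary.Decidable using (from-yes)
open import Relation.Nullary.Reflects using (ofʸ; ofⁿ)
open import Relation.Unary using (Decidable)

module Mod3 where

  data ℤ₃ : Set where
    [0] [1] [2] : ℤ₃

  infix  8 -₃_
  infixl 7 _*₃_
  infixl 6 _+₃_
  infix  4 _≟_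

  -₃_ : ℤ₃ → ℤ₃
  -₃ [0] = [0]
  -₃ [1] = [2]
  -₃ [2] = [1]

  _+₃_ : ℤ₃ → ℤ₃ → ℤ₃
  [0] +₃ y = y
  [1] +₃ [0] = [1]
  [1] +₃ [1] = [2]
  [1] +₃ [2] = [0]
  [2] +₃ [0] = [2]
  [2] +₃ [1] = [0]
  [2] +₃ [2] = [1]

  _*₃_ : ℤ₃ → ℤ₃ → ℤ₃
  [0] *₃ y = [0]
  [1] *₃ y = y
  [2] *₃ y = -₃ y

  _≟_ : DecidableEquality ℤ₃
  [0] ≟ [0] = yes refl
  [1] ≟ [1] = yes refl
  [2] ≟ [2] = yes refl
  [0] ≟ [1] = no λ ()
  [0] ≟ [2] = no λ ()
  [1] ≟ [0] = no λ ()
  [1] ≟ [2] = no λ ()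
  [2] ≟ [0] = no λ ()
  [2] ≟ [1] = no λ ()

  ∀? : ∀ {P : ℤ₃ → Set} → Decidable P → Dec (∀ x → P x)
  ∀? P? with P? [0] | P? [1] | P? [2]
  ... | yes p₀ | yes p₁ | yes p₂ = yes λ { [0] → p₀ ; [1] → p₁ ; [2] → p₂ }
  ... | no ¬p₀ | _      | _      = no λ p → ¬p₀ (p [0])
  ... | yes _  | no ¬p₁ | _      = no λ p → ¬p₁ (p [1])
  ... | yes _  | yes _  | no ¬p₂ = no λ p → ¬p₂ (p [2])

  isCommutativeRing : IsCommutativeRing _≡_ _+₃_ _*₃_ -₃_ [0] [1]
  isCommutativeRing = record
    { isRing = record
      { +-isAbelianGroup = record
        { isGroup = record
          { isMonoid = record
            { isSemigroup = record
              { isMagma = record { isEquivalence = isEquivalence ; ∙-cong = cong₂ _+₃_ }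
              ; assoc = from-yes (∀? λ x → ∀? λ y → ∀? λ z → (x +₃ y) +₃ z ≟ x +₃ (y +₃ z)) }
            ; identity = (λ _ → refl) , from-yes (∀? λ x → x +₃ [0] ≟ x) }
          ; inverse = from-yes (∀? λ x → -₃ x +₃ x ≟ [0]) , from-yes (∀? λ x → x +₃ -₃ x ≟ [0])
          ; ⁻¹-cong = cong -₃_ }
        ; comm = from-yes (∀? λ x → ∀? λ y → x +₃ y ≟ y +₃ x) }
      ; *-cong = cong₂ _*₃_
      ; *-assoc = from-yes (∀? λ x → ∀? λ y → ∀? λ z → (x *₃ y) *₃ z ≟ x *₃ (y *₃ z))
      ; *-identity = (λ _ → refl) , from-yes (∀? λ x → x *₃ [1] ≟ x)
      ; distrib = from-yes (∀? λ x → ∀? λ y → ∀? λ z → x *₃ (y +₃ z) ≟ x *₃ y +₃ x *₃ z)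
                , from-yes (∀? λ x → ∀? λ y → ∀? λ z → (y +₃ z) *₃ x ≟ y *₃ x +₃ z *₃ x) }
    ; *-comm = from-yes (∀? λ x → ∀? λ y → x *₃ y ≟ y *₃ x) }

  commutativeRing : CommutativeRing _ _
  commutativeRing = record { isCommutativeRing = isCommutativeRing }

  open CommutativeRing commutativeRing using (+-assoc; distribʳ)

  square≢[2] : ∀ x → x *₃ x ≢ [2]
  square≢[2] = from-yes (∀? λ x → ¬? (x *₃ x ≟ [2]))

  reduce : ℕ → ℤ₃
  reduce zero    = [0]
  reduce (suc n) = [1] +₃ reduce n

  reduce-+ : ∀ m n → reduce (m + n) ≡ reduce m +₃ reduce n
  reduce-+ zero    n = refl
  reduce-+ (suc m) n = trans (cong ([1] +₃_) (reduce-+ m n)) (sym (+-assoc [1] (reduce m) (reduce n)))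

  reduce-* : ∀ m n → reduce (m * n) ≡ reduce m *₃ reduce n
  reduce-* zero    n = refl
  reduce-* (suc m) n = begin
    reduce (n + m * n)              ≡⟨ reduce-+ n (m * n) ⟩
    reduce n +₃ reduce (m * n)     ≡⟨ cong (reduce n +₃_) (reduce-* m n) ⟩
    reduce n +₃ reduce m *₃ reduce n ≡⟨ sym (distribʳ (reduce n) [1] (reduce m)) ⟩
    ([1] +₃ reduce m) *₃ reduce n   ∎
    where open ≡-Reasoning

  reduce-3*-+ : ∀ n m → reduce (3 * n + m) ≡ reduce m
  reduce-3*-+ n m = trans (reduce-+ (3 * n) m) (cong (_+₃ reduce m) (reduce-* 3 n))

  reduce-3+ : ∀ n → reduce (3 + n) ≡ reduce n
  reduce-3+ n = from-yes (∀? λ x → [1] +₃ ([1] +₃ ([1] +₃ x)) ≟ x) (reduce n)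

  reduce≡[0]⇒3∣ : ∀ n → reduce n ≡ [0] → 3 ∣ n
  reduce≡[0]⇒3∣ zero                _  = divides 0 refl
  reduce≡[0]⇒3∣ (suc zero)          ()
  reduce≡[0]⇒3∣ (suc (suc zero))    ()
  reduce≡[0]⇒3∣ (suc (suc (suc n))) eq with reduce≡[0]⇒3∣ n (trans (sym (reduce-3+ n)) eq)
  ... | divides k n≡k*3 = divides (suc k) (cong (3 +_) n≡k*3)

open Mod3 using (ℤ₃; [0]; [1]; [2]; _+₃_; _*₃_; -₃_) renaming (commutativeRing to ℤ₃-commutativeRing)

module ℤ₃R = CommutativeRing ℤ₃-commutativeRing
module ℤ₃-+-group = Algebra.Properties.Group ℤ₃R.+-group

module SeriesRing where

  open import Data.Nat.Properties using (≤-refl; m≤n⇒m≤1+n)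

  private
    module ℤ₃-Solver = SimpleSolver (fromCommutativeRing ℤ₃-commutativeRing) Mod3._≟_

  Series : Set
  Series = ℕ → ℤ₃

  infix  8 -ₛ_
  infixl 7 _*ₛ_
  infixl 6 _+ₛ_
  infix  4 _≐_ _≈[_]_

  _≐_ : Series → Series → Set
  A ≐ B = ∀ n → A n ≡ B n

  _≈[_]_ : Series → ℕ → Series → Set
  A ≈[ D ] B = ∀ i → i ≤ D → A i ≡ B i

  const : ℤ₃ → Series
  const c zero    = c
  const c (suc n) = [0]

  0ₛ 1ₛ : Series
  0ₛ _ = [0]
  1ₛ   = const [1]

  _+ₛ_ : Series → Series → Series
  (A +ₛ B) n = A n +₃ B n

  -ₛ_ : Series → Series
  (-ₛ A) n = -₃ A n

  tail : Series → Series
  tail A n = A (suc n)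

  _*ₛ_ : Series → Series → Series
  (A *ₛ B) zero    = A 0 *₃ B 0
  (A *ₛ B) (suc n) = A 0 *₃ B (suc n) +₃ (tail A *ₛ B) n

  *ₛ-cong-≤ : ∀ {A A′ B B′} D → A ≈[ D ] A′ → B ≈[ D ] B′ → (A *ₛ B) D ≡ (A′ *ₛ B′) D
  *ₛ-cong-≤ zero    A≈ B≈ = cong₂ _*₃_ (A≈ 0 z≤n) (B≈ 0 z≤n)
  *ₛ-cong-≤ (suc D) A≈ B≈ = cong₂ _+₃_
    (cong₂ _*₃_ (A≈ 0 z≤n) (B≈ (suc D) ≤-refl))
    (*ₛ-cong-≤ D (λ i i≤D → A≈ (suc i) (s≤s i≤D)) (λ i i≤D → B≈ i (m≤n⇒m≤1+n i≤D)))

  open ℤ₃-Solver using (solve; _:+_; _:*_; _:=_)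

  *ₛ-distribʳ : ∀ A B C → (A +ₛ B) *ₛ C ≐ A *ₛ C +ₛ B *ₛ C
  *ₛ-distribʳ A B C zero    = ℤ₃R.distribʳ (C 0) (A 0) (B 0)
  *ₛ-distribʳ A B C (suc n) = begin
    (A 0 +₃ B 0) *₃ C (suc n) +₃ ((tail A +ₛ tail B) *ₛ C) n
      ≡⟨ cong ((A 0 +₃ B 0) *₃ C (suc n) +₃_) (*ₛ-distribʳ (tail A) (tail B) C n) ⟩
    (A 0 +₃ B 0) *₃ C (suc n) +₃ ((tail A *ₛ C) n +₃ (tail B *ₛ C) n)
      ≡⟨ solve 5 (λ a b c x y → (a :+ b) :* c :+ (x :+ y) := (a :* c :+ x) :+ (b :* c :+ y)) refl
           (A 0) (B 0) (C (suc n)) ((tail A *ₛ C) n) ((tail B *ₛ C) n) ⟩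
    (A *ₛ C +ₛ B *ₛ C) (suc n) ∎
    where open ≡-Reasoning

  *ₛ-distribˡ : ∀ A B C → A *ₛ (B +ₛ C) ≐ A *ₛ B +ₛ A *ₛ C
  *ₛ-distribˡ A B C zero    = ℤ₃R.distribˡ (A 0) (B 0) (C 0)
  *ₛ-distribˡ A B C (suc n) = begin
    A 0 *₃ (B (suc n) +₃ C (suc n)) +₃ (tail A *ₛ (B +ₛ C)) n
      ≡⟨ cong (A 0 *₃ (B (suc n) +₃ C (suc n)) +₃_) (*ₛ-distribˡ (tail A) B C n) ⟩
    A 0 *₃ (B (suc n) +₃ C (suc n)) +₃ ((tail A *ₛ B) n +₃ (tail A *ₛ C) n)
      ≡⟨ solve 5 (λ a b c x y → a :* (b :+ c) :+ (x :+ y) := (a :* b :+ x) :+ (a :* c :+ y)) refl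
           (A 0) (B (suc n)) (C (suc n)) ((tail A *ₛ B) n) ((tail A *ₛ C) n) ⟩
    (A *ₛ B +ₛ A *ₛ C) (suc n) ∎
    where open ≡-Reasoning

  *ₛ-scaleˡ : ∀ c A B → (λ i → c *₃ A i) *ₛ B ≐ λ n → c *₃ (A *ₛ B) n
  *ₛ-scaleˡ c A B zero    = ℤ₃R.*-assoc c (A 0) (B 0)
  *ₛ-scaleˡ c A B (suc n) = begin
    c *₃ A 0 *₃ B (suc n) +₃ ((λ i → c *₃ tail A i) *ₛ B) n
      ≡⟨ cong (c *₃ A 0 *₃ B (suc n) +₃_) (*ₛ-scaleˡ c (tail A) B n) ⟩
    c *₃ A 0 *₃ B (suc n) +₃ c *₃ (tail A *ₛ B) n
      ≡⟨ solve 4 (λ c a b x → c :* a :* b :+ c :* x := c :* (a :* b :+ x)) refl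
           c (A 0) (B (suc n)) ((tail A *ₛ B) n) ⟩
    c *₃ (A *ₛ B) (suc n) ∎
    where open ≡-Reasoning

  *ₛ-zeroˡ : ∀ B → 0ₛ *ₛ B ≐ 0ₛ
  *ₛ-zeroˡ B zero    = refl
  *ₛ-zeroˡ B (suc n) = *ₛ-zeroˡ B n

  *ₛ-identityˡ : ∀ B → 1ₛ *ₛ B ≐ B
  *ₛ-identityˡ B zero    = refl
  *ₛ-identityˡ B (suc n) = trans (cong (B (suc n) +₃_) (*ₛ-zeroˡ B n)) (ℤ₃R.+-identityʳ (B (suc n)))

  *ₛ-assoc : ∀ A B C → (A *ₛ B) *ₛ C ≐ A *ₛ (B *ₛ C)
  *ₛ-assoc A B C zero    = ℤ₃R.*-assoc (A 0) (B 0) (C 0)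
  *ₛ-assoc A B C (suc n) = begin
    A 0 *₃ B 0 *₃ C (suc n) +₃ (((λ i → A 0 *₃ tail B i) +ₛ tail A *ₛ B) *ₛ C) n
      ≡⟨ cong (A 0 *₃ B 0 *₃ C (suc n) +₃_) (*ₛ-distribʳ (λ i → A 0 *₃ tail B i) (tail A *ₛ B) C n) ⟩
    A 0 *₃ B 0 *₃ C (suc n) +₃ (((λ i → A 0 *₃ tail B i) *ₛ C) n +₃ ((tail A *ₛ B) *ₛ C) n)
      ≡⟨ cong (A 0 *₃ B 0 *₃ C (suc n) +₃_)
           (cong₂ _+₃_ (*ₛ-scaleˡ (A 0) (tail B) C n) (*ₛ-assoc (tail A) B C n)) ⟩
    A 0 *₃ B 0 *₃ C (suc n) +₃ (A 0 *₃ (tail B *ₛ C) n +₃ (tail A *ₛ (B *ₛ C)) n)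
      ≡⟨ solve 5 (λ a b c d x → a :* b :* c :+ (a :* d :+ x) := a :* (b :* c :+ d) :+ x) refl
           (A 0) (B 0) (C (suc n)) ((tail B *ₛ C) n) ((tail A *ₛ (B *ₛ C)) n) ⟩
    (A *ₛ (B *ₛ C)) (suc n) ∎
    where open ≡-Reasoning

  -- Commutativity at degree n+2 needs the hypothesis at degrees n and n+1 (for tails of both factors).
  *ₛ-comm-upTo : ∀ n → (∀ A B → (A *ₛ B) n ≡ (B *ₛ A) n) × (∀ A B → (A *ₛ B) (suc n) ≡ (B *ₛ A) (suc n))
  *ₛ-comm-upTo zero = (λ A B → ℤ₃R.*-comm (A 0) (B 0)) , λ A B →
    solve 4 (λ a₀ a₁ b₀ b₁ → a₀ :* b₁ :+ a₁ :* b₀ := b₀ :* a₁ :+ b₁ :* a₀) refl (A 0) (A 1) (B 0) (B 1)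
  *ₛ-comm-upTo (suc n) = proj₂ ih , step
    where
    ih = *ₛ-comm-upTo n
    step : ∀ A B → (A *ₛ B) (2 + n) ≡ (B *ₛ A) (2 + n)
    step A B = begin
      A 0 *₃ B (2 + n) +₃ (tail A *ₛ B) (suc n)
        ≡⟨ cong (A 0 *₃ B (2 + n) +₃_) (proj₂ ih (tail A) B) ⟩
      A 0 *₃ B (2 + n) +₃ (B 0 *₃ A (2 + n) +₃ (tail B *ₛ tail A) n)
        ≡⟨ cong (λ x → A 0 *₃ B (2 + n) +₃ (B 0 *₃ A (2 + n) +₃ x)) (proj₁ ih (tail B) (tail A)) ⟩
      A 0 *₃ B (2 + n) +₃ (B 0 *₃ A (2 + n) +₃ (tail A *ₛ tail B) n)
        ≡⟨ solve 5 (λ a b c d x → a :* b :+ (c :* d :+ x) := c :* d :+ (a :* b :+ x)) refl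
             (A 0) (B (2 + n)) (B 0) (A (2 + n)) ((tail A *ₛ tail B) n) ⟩
      B 0 *₃ A (2 + n) +₃ (A *ₛ tail B) (suc n)
        ≡⟨ cong (B 0 *₃ A (2 + n) +₃_) (proj₂ ih A (tail B)) ⟩
      (B *ₛ A) (2 + n) ∎
      where open ≡-Reasoning

  *ₛ-comm : ∀ A B → A *ₛ B ≐ B *ₛ A
  *ₛ-comm A B n = proj₁ (*ₛ-comm-upTo n) A B

  isCommutativeRing : IsCommutativeRing _≐_ _+ₛ_ _*ₛ_ -ₛ_ 0ₛ 1ₛ
  isCommutativeRing = record
    { isRing = record
      { +-isAbelianGroup = record
        { isGroup = record
          { isMonoid = record
            { isSemigroup = record
              { isMagma = record
                { isEquivalence = record
                  { refl = λ _ → refl ; sym = λ p n → sym (p n) ; trans = λ p q n → trans (p n) (q n) }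
                ; ∙-cong = λ p q n → cong₂ _+₃_ (p n) (q n) }
              ; assoc = λ A B C n → ℤ₃R.+-assoc (A n) (B n) (C n) }
            ; identity = (λ A n → ℤ₃R.+-identityˡ (A n)) , (λ A n → ℤ₃R.+-identityʳ (A n)) }
          ; inverse = (λ A n → ℤ₃R.-‿inverseˡ (A n)) , (λ A n → ℤ₃R.-‿inverseʳ (A n))
          ; ⁻¹-cong = λ p n → cong -₃_ (p n) }
        ; comm = λ A B n → ℤ₃R.+-comm (A n) (B n) }
      ; *-cong = λ A≐ B≐ n → *ₛ-cong-≤ n (λ i _ → A≐ i) (λ i _ → B≐ i)
      ; *-assoc = *ₛ-assoc
      ; *-identity = *ₛ-identityˡ , λ A n → trans (*ₛ-comm A 1ₛ n) (*ₛ-identityˡ A n)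
      ; distrib = *ₛ-distribˡ , λ C A B → *ₛ-distribʳ A B C }
    ; *-comm = *ₛ-comm }

  commutativeRing : CommutativeRing _ _
  commutativeRing = record { isCommutativeRing = isCommutativeRing }

  const-homomorphism : CommutativeRing.rawRing ℤ₃-commutativeRing
                         -Raw-AlmostCommutative⟶ fromCommutativeRing commutativeRing
  const-homomorphism = record
    { ⟦_⟧    = const
    ; +-homo = λ { _ _ zero → refl ; _ _ (suc n) → refl }
    ; *-homo = λ { _ _ zero → refl ; a b (suc n) → sym (cong₂ _+₃_ (ℤ₃R.zeroʳ a) (*ₛ-zeroˡ (const b) n)) }
    ; -‿homo = λ { _ zero → refl ; _ (suc n) → refl }
    ; 0-homo = λ { zero → refl ; (suc n) → refl }
    ; 1-homo = λ _ → refl }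

  const-≟ : ∀ a b → Maybe (const a ≐ const b)
  const-≟ a b with Mod3._≟_ a b
  ... | yes refl = just λ _ → refl
  ... | no _     = nothing

  module Solver = RingSolver (CommutativeRing.rawRing ℤ₃-commutativeRing)
                    (fromCommutativeRing commutativeRing) const-homomorphism const-≟

module PowerSeries where

  open SeriesRing public
  open import Data.Nat.Properties
    using ( ≤-refl; ≤-trans; ≤-<-trans; m≤n⇒m≤1+n; m<n⇒m<1+n; m≤m+n; m≤n+m; m+[n∸m]≡n; m∸n+n≡m
          ; +-identityʳ; +-suc; *-suc; m≤n⇒m<n∨m≡n)

  module S = CommutativeRing commutativeRing

  ≐-reflexive : ∀ {A B} → A ≡ B → A ≐ B
  ≐-reflexive refl _ = refl

  ≐⇒≈ : ∀ {D A B} → A ≐ B → A ≈[ D ] B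
  ≐⇒≈ A≐B i _ = A≐B i

  ≈-setoid : ℕ → Setoid _ _
  ≈-setoid D = record
    { Carrier = Series
    ; _≈_ = _≈[ D ]_
    ; isEquivalence = record
      { refl = λ _ _ → refl ; sym = λ p i i≤D → sym (p i i≤D) ; trans = λ p q i i≤D → trans (p i i≤D) (q i i≤D) } }

  module ≈ {D : ℕ} = Setoid (≈-setoid D)

  +ₛ-cong-≈ : ∀ {D A A′ B B′} → A ≈[ D ] A′ → B ≈[ D ] B′ → A +ₛ B ≈[ D ] A′ +ₛ B′
  +ₛ-cong-≈ A≈ B≈ i i≤D = cong₂ _+₃_ (A≈ i i≤D) (B≈ i i≤D)

  *ₛ-cong-≈ : ∀ {D A A′ B B′} → A ≈[ D ] A′ → B ≈[ D ] B′ → A *ₛ B ≈[ D ] A′ *ₛ B′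
  *ₛ-cong-≈ A≈ B≈ i i≤D =
    *ₛ-cong-≤ i (λ j j≤i → A≈ j (≤-trans j≤i i≤D)) (λ j j≤i → B≈ j (≤-trans j≤i i≤D))

  infix 9 q^_ 1-q^_

  shift : Series → Series
  shift A zero    = [0]
  shift A (suc n) = A n

  shiftBy : ℕ → Series → Series
  shiftBy zero    A = A
  shiftBy (suc a) A = shift (shiftBy a A)

  q^_ : ℕ → Series
  q^ a = shiftBy a 1ₛ

  1-q^_ : ℕ → Series
  1-q^ w = 1ₛ +ₛ -ₛ q^ w

  shift-cong : ∀ {A B} → A ≐ B → shift A ≐ shift B
  shift-cong A≐B zero    = refl
  shift-cong A≐B (suc n) = A≐B n

  shiftBy-cong : ∀ a {A B} → A ≐ B → shiftBy a A ≐ shiftBy a B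
  shiftBy-cong zero    A≐B = A≐B
  shiftBy-cong (suc a) A≐B = shift-cong (shiftBy-cong a A≐B)

  shiftBy-*ₛ : ∀ a A B → shiftBy a A *ₛ B ≐ shiftBy a (A *ₛ B)
  shiftBy-*ₛ zero    A B n       = refl
  shiftBy-*ₛ (suc a) A B zero    = refl
  shiftBy-*ₛ (suc a) A B (suc n) = shiftBy-*ₛ a A B n

  shiftBy-< : ∀ {a n} A → n < a → shiftBy a A n ≡ [0]
  shiftBy-< {suc a} {zero}  A _         = refl
  shiftBy-< {suc a} {suc n} A (s≤s n<a) = shiftBy-< A n<a

  shiftBy-+ : ∀ a A m → shiftBy a A (a + m) ≡ A m
  shiftBy-+ zero    A m = refl
  shiftBy-+ (suc a) A m = shiftBy-+ a A m

  shiftBy-+-comp : ∀ a b A → shiftBy (a + b) A ≐ shiftBy a (shiftBy b A)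
  shiftBy-+-comp zero    b A = λ _ → refl
  shiftBy-+-comp (suc a) b A = shift-cong (shiftBy-+-comp a b A)

  q^-*ₛ : ∀ a B → q^ a *ₛ B ≐ shiftBy a B
  q^-*ₛ a B n = trans (shiftBy-*ₛ a 1ₛ B n) (shiftBy-cong a (*ₛ-identityˡ B) n)

  q^-+ : ∀ a b → q^ a *ₛ q^ b ≐ q^ (a + b)
  q^-+ a b n = trans (q^-*ₛ a (q^ b) n) (sym (shiftBy-+-comp a b 1ₛ n))

  q^-≢ : ∀ a {n} → n ≢ a → (q^ a) n ≡ [0]
  q^-≢ zero    {zero}  n≢a = contradiction refl n≢a
  q^-≢ zero    {suc n} n≢a = refl
  q^-≢ (suc a) {zero}  n≢a = refl
  q^-≢ (suc a) {suc n} n≢a = q^-≢ a (n≢a ∘ cong suc)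

  q^-*ₛ-≈0 : ∀ {D} a B → D < a → q^ a *ₛ B ≈[ D ] 0ₛ
  q^-*ₛ-≈0 a B D<a i i≤D = trans (q^-*ₛ a B i) (shiftBy-< B (≤-<-trans i≤D D<a))

  q^-≈0 : ∀ {D} a → D < a → q^ a ≈[ D ] 0ₛ
  q^-≈0 a D<a i i≤D = shiftBy-< 1ₛ (≤-<-trans i≤D D<a)

  1-q^-≈1 : ∀ {D} w → D < w → 1-q^ w ≈[ D ] 1ₛ
  1-q^-≈1 w D<w i i≤D = trans (cong (λ x → 1ₛ i +₃ -₃ x) (q^-≈0 w D<w i i≤D)) (ℤ₃R.+-identityʳ (1ₛ i))

  open import Algebra.Properties.Ring S.ring public using (-‿involutive)
  open import Algebra.Properties.Semiring.Exp S.semiring public using (_^_; ^-congˡ; ^-homo-*)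
  open import Algebra.Properties.CommutativeSemiring.Exp S.commutativeSemiring public using (^-distrib-*)
  open Solver using (solve; _:+_; _:*_; _:-_; _:^_; _:=_; con)

  -- Frobenius in characteristic 3.
  1-q^-cube : ∀ w → (1-q^ w) ^ 3 ≐ 1-q^ (3 * w)
  1-q^-cube w = begin
    (1-q^ w) ^ 3           ≈⟨ solve 1 (λ x → (con [1] :- x) :^ 3 := con [1] :- x :^ 3) S.refl (q^ w) ⟩
    1ₛ +ₛ -ₛ (q^ w ^ 3)     ≈⟨ S.+-congˡ (S.-‿cong q^w³) ⟩
    1-q^ (3 * w)           ∎
    where
    open SetoidReasoning S.setoid
    q^w³ : q^ w ^ 3 ≐ q^ (3 * w)
    q^w³ = begin
      q^ w *ₛ (q^ w *ₛ (q^ w *ₛ 1ₛ)) ≈⟨ S.*-congˡ (S.*-congˡ (S.*-identityʳ (q^ w))) ⟩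
      q^ w *ₛ (q^ w *ₛ q^ w)         ≈⟨ S.trans (S.*-congˡ (q^-+ w w)) (q^-+ w (w + w)) ⟩
      q^ (w + (w + w))               ≈⟨ ≐-reflexive (cong (λ x → q^ (w + (w + x))) (sym (+-identityʳ w))) ⟩
      q^ (3 * w)                     ∎

  ^-at0 : ∀ A e → A 0 ≡ [1] → (A ^ e) 0 ≡ [1]
  ^-at0 A zero    A₀ = refl
  ^-at0 A (suc e) A₀ = cong₂ _*₃_ A₀ (^-at0 A e A₀)

  ^-≈1 : ∀ {D A} e → A ≈[ D ] 1ₛ → A ^ e ≈[ D ] 1ₛ
  ^-≈1 zero    A≈1 = ≈.refl
  ^-≈1 (suc e) A≈1 = ≈.trans (*ₛ-cong-≈ A≈1 (^-≈1 e A≈1)) (≐⇒≈ (S.*-identityˡ 1ₛ))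

  infix 8 ∏[<_]_ ∑[<_]_

  ∏[<_]_ : ℕ → (ℕ → Series) → Series
  ∏[< zero  ] F = 1ₛ
  ∏[< suc n ] F = ∏[< n ] F *ₛ F n

  ∑[<_]_ : ℕ → (ℕ → Series) → Series
  ∑[< zero  ] F = 0ₛ
  ∑[< suc n ] F = ∑[< n ] F +ₛ F n

  ∏-cong : ∀ {F G} n → (∀ i → i < n → F i ≐ G i) → ∏[< n ] F ≐ ∏[< n ] G
  ∏-cong zero    F≐G = S.refl
  ∏-cong (suc n) F≐G = S.*-cong (∏-cong n λ i i<n → F≐G i (m<n⇒m<1+n i<n)) (F≐G n ≤-refl)

  ∏-≈1 : ∀ {D F} n → (∀ i → i < n → F i ≈[ D ] 1ₛ) → ∏[< n ] F ≈[ D ] 1ₛ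
  ∏-≈1 zero    F≈1 = ≈.refl
  ∏-≈1 (suc n) F≈1 = ≈.trans (*ₛ-cong-≈ (∏-≈1 n λ i i<n → F≈1 i (m<n⇒m<1+n i<n)) (F≈1 n ≤-refl))
                             (≐⇒≈ (S.*-identityˡ 1ₛ))

  ∏-at0 : ∀ F n → (∀ i → F i 0 ≡ [1]) → (∏[< n ] F) 0 ≡ [1]
  ∏-at0 F zero    F₀ = refl
  ∏-at0 F (suc n) F₀ = cong₂ _*₃_ (∏-at0 F n F₀) (F₀ n)

  ∏-*ₛ : ∀ F G n → ∏[< n ] (λ i → F i *ₛ G i) ≐ (∏[< n ] F) *ₛ (∏[< n ] G)
  ∏-*ₛ F G zero    = S.sym (S.*-identityˡ 1ₛ)
  ∏-*ₛ F G (suc n) = S.trans (S.*-congʳ (∏-*ₛ F G n))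
    (solve 4 (λ p q f g → (p :* q) :* (f :* g) := (p :* f) :* (q :* g)) S.refl
       (∏[< n ] F) (∏[< n ] G) (F n) (G n))

  ∏-^ : ∀ F e n → (∏[< n ] F) ^ e ≐ ∏[< n ] (λ i → F i ^ e)
  ∏-^ F e zero    = 1ₛ-^ e
    where
    1ₛ-^ : ∀ e → 1ₛ ^ e ≐ 1ₛ
    1ₛ-^ zero    = S.refl
    1ₛ-^ (suc e) = S.trans (S.*-identityˡ (1ₛ ^ e)) (1ₛ-^ e)
  ∏-^ F e (suc n) = S.trans (^-distrib-* (∏[< n ] F) (F n) e) (S.*-congʳ (∏-^ F e n))

  ∏-head : ∀ F n → ∏[< suc n ] F ≐ F 0 *ₛ ∏[< n ] (F ∘ suc)
  ∏-head F zero    = S.*-comm 1ₛ (F 0)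
  ∏-head F (suc n) = S.trans (S.*-congʳ (∏-head F n)) (S.*-assoc (F 0) (∏[< n ] (F ∘ suc)) (F (suc n)))

  ∏-+ : ∀ F a d → ∏[< a + d ] F ≐ (∏[< a ] F) *ₛ ∏[< d ] (λ i → F (a + i))
  ∏-+ F a zero    = S.trans (≐-reflexive (cong (∏[<_] F) (+-identityʳ a))) (S.sym (S.*-identityʳ _))
  ∏-+ F a (suc d) = S.trans (≐-reflexive (cong (∏[<_] F) (+-suc a d)))
    (S.trans (S.*-congʳ (∏-+ F a d)) (S.*-assoc (∏[< a ] F) _ (F (a + d))))

  ∏-extend-≈ : ∀ {D} F {a b} → a ≤ b → (∀ i → a ≤ i → F i ≈[ D ] 1ₛ) → ∏[< b ] F ≈[ D ] ∏[< a ] F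
  ∏-extend-≈ F {a} {b} a≤b F≈1 = begin
    ∏[< b ] F                                   ≡⟨ cong (∏[<_] F) (sym (m+[n∸m]≡n a≤b)) ⟩
    ∏[< a + (b ∸ a) ] F                         ≈⟨ ≐⇒≈ (∏-+ F a (b ∸ a)) ⟩
    (∏[< a ] F) *ₛ ∏[< b ∸ a ] (λ i → F (a + i)) ≈⟨ *ₛ-cong-≈ ≈.refl (∏-≈1 (b ∸ a) λ i _ → F≈1 _ (m≤m+n a i)) ⟩
    (∏[< a ] F) *ₛ 1ₛ                           ≈⟨ ≐⇒≈ (S.*-identityʳ _) ⟩
    ∏[< a ] F                                   ∎
    where open SetoidReasoning (≈-setoid _)

  ∏-pairs : ∀ G K → ∏[< 2 * K ] G ≐ ∏[< K ] (λ i → G (2 * i) *ₛ G (suc (2 * i)))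
  ∏-pairs G zero    = S.refl
  ∏-pairs G (suc K) = S.trans (≐-reflexive (cong (∏[<_] G) (*-suc 2 K)))
    (S.trans (S.*-assoc (∏[< 2 * K ] G) (G (2 * K)) (G (suc (2 * K))))
             (S.*-congʳ (∏-pairs G K)))

  ∑-cong : ∀ {F G} n → (∀ i → i < n → F i ≐ G i) → ∑[< n ] F ≐ ∑[< n ] G
  ∑-cong zero    F≐G = S.refl
  ∑-cong (suc n) F≐G = S.+-cong (∑-cong n λ i i<n → F≐G i (m<n⇒m<1+n i<n)) (F≐G n ≤-refl)

  ∑-cong-≈ : ∀ {D F G} n → (∀ i → i < n → F i ≈[ D ] G i) → ∑[< n ] F ≈[ D ] ∑[< n ] G
  ∑-cong-≈ zero    F≈G = ≈.refl
  ∑-cong-≈ (suc n) F≈G = +ₛ-cong-≈ (∑-cong-≈ n λ i i<n → F≈G i (m<n⇒m<1+n i<n)) (F≈G n ≤-refl)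

  ∑-+ₛ : ∀ F G n → ∑[< n ] (λ i → F i +ₛ G i) ≐ ∑[< n ] F +ₛ ∑[< n ] G
  ∑-+ₛ F G zero    = S.sym (S.+-identityˡ 0ₛ)
  ∑-+ₛ F G (suc n) = S.trans (S.+-congʳ (∑-+ₛ F G n))
    (solve 4 (λ a b c d → (a :+ b) :+ (c :+ d) := (a :+ c) :+ (b :+ d)) S.refl (∑[< n ] F) (∑[< n ] G) (F n) (G n))

  ∑-*ₛʳ : ∀ F B n → (∑[< n ] F) *ₛ B ≐ ∑[< n ] (λ i → F i *ₛ B)
  ∑-*ₛʳ F B zero    = S.zeroˡ B
  ∑-*ₛʳ F B (suc n) = S.trans (S.distribʳ B (∑[< n ] F) (F n)) (S.+-congʳ (∑-*ₛʳ F B n))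

  ∑-*ₛˡ : ∀ B F n → B *ₛ ∑[< n ] F ≐ ∑[< n ] (λ i → B *ₛ F i)
  ∑-*ₛˡ B F n = S.trans (S.*-comm B (∑[< n ] F))
    (S.trans (∑-*ₛʳ F B n) (∑-cong n λ i _ → S.*-comm (F i) B))

  ∑-head : ∀ F n → ∑[< suc n ] F ≐ F 0 +ₛ ∑[< n ] (F ∘ suc)
  ∑-head F zero    = S.+-comm 0ₛ (F 0)
  ∑-head F (suc n) = S.trans (S.+-congʳ (∑-head F n)) (S.+-assoc (F 0) (∑[< n ] (F ∘ suc)) (F (suc n)))

  ∑-extend : ∀ F {a b} → a ≤ b → (∀ i → a ≤ i → F i ≐ 0ₛ) → ∑[< b ] F ≐ ∑[< a ] F
  ∑-extend F {a} {b} a≤b F≐0 = S.trans (≐-reflexive (cong (∑[<_] F) (sym (m∸n+n≡m a≤b)))) (extend (b ∸ a))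
    where
    extend : ∀ d → ∑[< d + a ] F ≐ ∑[< a ] F
    extend zero    = S.refl
    extend (suc d) = S.trans (S.+-cong (extend d) (F≐0 (d + a) (m≤n+m a d))) (S.+-identityʳ _)

  ≈[0]-intro : ∀ {A B} → A 0 ≡ B 0 → A ≈[ 0 ] B
  ≈[0]-intro eq zero z≤n = eq

  ≈[suc]-intro : ∀ {D A B} → A ≈[ D ] B → A (suc D) ≡ B (suc D) → A ≈[ suc D ] B
  ≈[suc]-intro A≈B eq i i≤1+D with m≤n⇒m<n∨m≡n i≤1+D
  ... | inj₁ (s≤s i≤D) = A≈B i i≤D
  ... | inj₂ refl      = eq

  *ₛ-cancelˡ-≈0 : ∀ {V X} D → V 0 ≡ [1] → V *ₛ X ≈[ D ] 0ₛ → X ≈[ D ] 0ₛ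
  *ₛ-cancelˡ-≈0 {V} {X} zero    V₀ VX≈0 = ≈[0]-intro (trans (cong (_*₃ X 0) (sym V₀)) (VX≈0 0 z≤n))
  *ₛ-cancelˡ-≈0 {V} {X} (suc D) V₀ VX≈0 = ≈[suc]-intro X≈0 (begin
    X (suc D)                                 ≡⟨ sym (ℤ₃R.+-identityʳ _) ⟩
    [1] *₃ X (suc D) +₃ [0]                   ≡⟨ cong₂ (λ v t → v *₃ X (suc D) +₃ t) (sym V₀) (sym tailV*X) ⟩
    V 0 *₃ X (suc D) +₃ (tail V *ₛ X) D       ≡⟨ VX≈0 (suc D) ≤-refl ⟩
    [0]                                       ∎)
    where
    open ≡-Reasoning
    X≈0 : X ≈[ D ] 0ₛ
    X≈0 = *ₛ-cancelˡ-≈0 D V₀ λ i i≤D → VX≈0 i (m≤n⇒m≤1+n i≤D)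
    tailV*X : (tail V *ₛ X) D ≡ [0]
    tailV*X = trans (*ₛ-cong-≤ D ≈.refl X≈0) (S.zeroʳ (tail V) D)

  *ₛ-cancelˡ : ∀ {V A B} → V 0 ≡ [1] → V *ₛ A ≐ V *ₛ B → A ≐ B
  *ₛ-cancelˡ {V} {A} {B} V₀ VA≐VB n =
    ℤ₃-+-group.x∙y⁻¹≈ε⇒x≈y (A n) (B n) (*ₛ-cancelˡ-≈0 n V₀ (≐⇒≈ V[A-B]≐0) n ≤-refl)
    where
    V[A-B]≐0 : V *ₛ (A +ₛ -ₛ B) ≐ 0ₛ
    V[A-B]≐0 = S.trans (solve 3 (λ v a b → v :* (a :- b) := v :* a :- v :* b) S.refl V A B)
                       (S.trans (S.+-congʳ VA≐VB) (S.-‿inverseʳ (V *ₛ B)))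

module Residues where

  open PowerSeries
  open Mod3 using (reduce; reduce-*; _≟_)
  open Solver using (solve; _:+_; _:-_; _:=_)
  open import Data.Nat.Properties using (≤-refl)

  SupportedOn : (ℤ₃ → Set) → Series → Set
  SupportedOn P A = ∀ n → ¬ P (reduce n) → A n ≡ [0]

  InQ³ : Series → Set
  InQ³ = SupportedOn (_≡ [0])

  supportedOn-cong : ∀ {P A B} → A ≐ B → SupportedOn P A → SupportedOn P B
  supportedOn-cong A≐B A-supp n ¬Pn = trans (sym (A≐B n)) (A-supp n ¬Pn)

  *ₛ-supportedOn : ∀ P {A V} → SupportedOn P A → InQ³ V → SupportedOn P (A *ₛ V)
  *ₛ-supportedOn P {A} {V} A-supp V-supp zero    ¬P0 = cong (_*₃ V 0) (A-supp 0 ¬P0)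
  *ₛ-supportedOn P {A} {V} A-supp V-supp (suc n) ¬P1+n = cong₂ _+₃_ head
    (*ₛ-supportedOn (λ c → P ([1] +₃ c)) (λ i → A-supp (suc i)) V-supp n ¬P1+n)
    where
    head : A 0 *₃ V (suc n) ≡ [0]
    head with reduce (suc n) ≟ [0]
    ... | yes 1+n≡0 = cong (_*₃ V (suc n)) (A-supp 0 λ P0 → ¬P1+n (subst P (sym 1+n≡0) P0))
    ... | no  1+n≢0 = trans (cong (A 0 *₃_) (V-supp (suc n) 1+n≢0)) (ℤ₃R.zeroʳ (A 0))

  InQ³-1ₛ : InQ³ 1ₛ
  InQ³-1ₛ zero    0≢0 = contradiction refl 0≢0
  InQ³-1ₛ (suc n) _   = refl

  InQ³-*ₛ : ∀ {A B} → InQ³ A → InQ³ B → InQ³ (A *ₛ B)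
  InQ³-*ₛ = *ₛ-supportedOn (_≡ [0])

  InQ³-^ : ∀ {A} e → InQ³ A → InQ³ (A ^ e)
  InQ³-^ zero    _     = InQ³-1ₛ
  InQ³-^ (suc e) A-q³ = InQ³-*ₛ A-q³ (InQ³-^ e A-q³)

  InQ³-∏ : ∀ {F} n → (∀ i → InQ³ (F i)) → InQ³ (∏[< n ] F)
  InQ³-∏ zero    _    = InQ³-1ₛ
  InQ³-∏ (suc n) F-q³ = InQ³-*ₛ (InQ³-∏ n F-q³) (F-q³ n)

  InQ³-1-q^3* : ∀ w → InQ³ (1-q^ (3 * w))
  InQ³-1-q^3* w n n≢0 = cong₂ (λ x y → x +₃ -₃ y) (InQ³-1ₛ n n≢0) (q^-≢ (3 * w) n≢3w)
    where
    n≢3w : n ≢ 3 * w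
    n≢3w n≡3w = n≢0 (trans (cong reduce n≡3w) (reduce-* 3 w))

  InQ³-const : ∀ c → InQ³ (const c)
  InQ³-const c zero    0≢0 = contradiction refl 0≢0
  InQ³-const c (suc n) _   = refl

  q^-supportedOn : ∀ {P} e → P (reduce e) → SupportedOn P (q^ e)
  q^-supportedOn {P} e Pe n ¬Pn = q^-≢ e λ n≡e → ¬Pn (subst (P ∘ reduce) (sym n≡e) Pe)

  ∑-supportedOn : ∀ {P F} n → (∀ i → SupportedOn P (F i)) → SupportedOn P (∑[< n ] F)
  ∑-supportedOn         zero    F-supp m ¬Pm = refl
  ∑-supportedOn {P} {F} (suc n) F-supp m ¬Pm = cong₂ _+₃_ (∑-supportedOn {P} {F} n F-supp m ¬Pm) (F-supp n m ¬Pm)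

  restrict : ℤ₃ → Series → Series
  restrict c A n with reduce n ≟ c
  ... | yes _ = A n
  ... | no  _ = [0]

  restrict-≡ : ∀ {c n} A → reduce n ≡ c → restrict c A n ≡ A n
  restrict-≡ {c} {n} A n≡c with reduce n ≟ c
  ... | yes _   = refl
  ... | no  n≢c = contradiction n≡c n≢c

  restrict-≐0 : ∀ {c} A → SupportedOn (_≢ c) A → restrict c A ≐ 0ₛ
  restrict-≐0 {c} A A-supp n with reduce n ≟ c
  ... | yes n≡c = A-supp n λ n≢c → n≢c n≡c
  ... | no  _   = refl

  restrict-cong-≈ : ∀ {D A B} c → A ≈[ D ] B → restrict c A ≈[ D ] restrict c B
  restrict-cong-≈ c A≈B i i≤D with reduce i ≟ c
  ... | yes _ = A≈B i i≤D
  ... | no  _ = refl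

  restrict-supportedOn : ∀ c A → SupportedOn (_≡ c) (restrict c A)
  restrict-supportedOn c A m m≢c with reduce m ≟ c
  ... | yes m≡c = contradiction m≡c m≢c
  ... | no  _   = refl

  unrestricted-supportedOn : ∀ c A → SupportedOn (_≢ c) (A +ₛ -ₛ restrict c A)
  unrestricted-supportedOn c A m ¬m≢c with reduce m ≟ c
  ... | yes _   = ℤ₃R.-‿inverseʳ (A m)
  ... | no  m≢c = contradiction m≢c ¬m≢c

  restrict-*ₛ : ∀ c A {V} → InQ³ V → restrict c (A *ₛ V) ≐ restrict c A *ₛ V
  restrict-*ₛ c A {V} V-q³ n with reduce n ≟ c
  ... | no  n≢c = sym (*ₛ-supportedOn (_≡ c) (restrict-supportedOn c A) V-q³ n n≢c)
  ... | yes n≡c = begin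
    (A *ₛ V) n                                 ≡⟨ S.*-congʳ A≐in+out n ⟩
    ((restrict c A +ₛ outside) *ₛ V) n         ≡⟨ S.distribʳ V (restrict c A) outside n ⟩
    (restrict c A *ₛ V) n +₃ (outside *ₛ V) n  ≡⟨ cong ((restrict c A *ₛ V) n +₃_) outside*V≡0 ⟩
    (restrict c A *ₛ V) n +₃ [0]               ≡⟨ ℤ₃R.+-identityʳ _ ⟩
    (restrict c A *ₛ V) n                      ∎
    where
    open ≡-Reasoning
    outside : Series
    outside = A +ₛ -ₛ restrict c A
    A≐in+out : A ≐ restrict c A +ₛ outside
    A≐in+out = solve 2 (λ a r → a := r :+ (a :- r)) S.refl A (restrict c A)
    outside*V≡0 : (outside *ₛ V) n ≡ [0]
    outside*V≡0 = *ₛ-supportedOn (_≢ c) (unrestricted-supportedOn c A) V-q³ n λ n≢c → n≢c n≡c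

  -- restrict c C · V = restrict c (C V) ≈ restrict c Φ = 0, and V is a unit.
  coefficient-vanishes : ∀ {C V Φ} D c → InQ³ V → V 0 ≡ [1] → C *ₛ V ≈[ D ] Φ →
                         SupportedOn (_≢ c) Φ → reduce D ≡ c → C D ≡ [0]
  coefficient-vanishes {C} {V} {Φ} D c V-q³ V₀ CV≈Φ Φ-supp D≡c =
    trans (sym (restrict-≡ C D≡c)) (*ₛ-cancelˡ-≈0 D V₀ V*restrict≈0 D ≤-refl)
    where
    open SetoidReasoning (≈-setoid D)
    V*restrict≈0 : V *ₛ restrict c C ≈[ D ] 0ₛ
    V*restrict≈0 = begin
      V *ₛ restrict c C      ≈⟨ ≐⇒≈ (S.trans (S.*-comm V (restrict c C)) (S.sym (restrict-*ₛ c C V-q³))) ⟩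
      restrict c (C *ₛ V)    ≈⟨ restrict-cong-≈ c CV≈Φ ⟩
      restrict c Φ           ≈⟨ ≐⇒≈ (restrict-≐0 Φ Φ-supp) ⟩
      0ₛ                     ∎

module NatSums where

  open import Data.Nat.Properties using (≤ᵇ-reflects-≤)

  sumBelow : ℕ → (ℕ → ℕ) → ℕ
  sumBelow zero    f = 0
  sumBelow (suc n) f = f 0 + sumBelow n (f ∘ suc)

  sum-map-applyUpTo : ∀ (h g : ℕ → ℕ) n → sum (map h (applyUpTo g n)) ≡ sumBelow n (h ∘ g)
  sum-map-applyUpTo h g zero    = refl
  sum-map-applyUpTo h g (suc n) = cong (h (g 0) +_) (sum-map-applyUpTo h (g ∘ suc) n)

  sumBelow-cong : ∀ {f g} n → (∀ m → f m ≡ g m) → sumBelow n f ≡ sumBelow n g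
  sumBelow-cong zero    f≡g = refl
  sumBelow-cong (suc n) f≡g = cong₂ _+_ (f≡g 0) (sumBelow-cong n (f≡g ∘ suc))

  sumBelow-extend : ∀ f {a b} → a ≤ b → (∀ m → a ≤ m → f m ≡ 0) → sumBelow b f ≡ sumBelow a f
  sumBelow-extend f {zero}  {zero}  _         _    = refl
  sumBelow-extend f {zero}  {suc b} _         f≡0 =
    cong₂ _+_ (f≡0 0 z≤n) (sumBelow-extend (f ∘ suc) {b = b} z≤n λ m _ → f≡0 (suc m) z≤n)
  sumBelow-extend f {suc a} {suc b} (s≤s a≤b) f≡0 =
    cong (f 0 +_) (sumBelow-extend (f ∘ suc) a≤b λ m a≤m → f≡0 (suc m) (s≤s a≤m))

  if-≤ᵇ-true : ∀ {m n} {A : Set} {x y : A} → m ≤ n → (if m ≤ᵇ n then x else y) ≡ x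
  if-≤ᵇ-true {m} {n} m≤n with m ≤ᵇ n | ≤ᵇ-reflects-≤ m n
  ... | true  | _       = refl
  ... | false | ofⁿ m≰n = contradiction m≤n m≰n

  if-≤ᵇ-false : ∀ {m n} {A : Set} {x y : A} → m ≰ n → (if m ≤ᵇ n then x else y) ≡ y
  if-≤ᵇ-false {m} {n} m≰n with m ≤ᵇ n | ≤ᵇ-reflects-≤ m n
  ... | true  | ofʸ m≤n = contradiction m≤n m≰n
  ... | false | _       = refl

module MultisetCounting where

  open import Data.Nat.Properties
    using ( <⇒≱; ≤-trans; m≤m+n; m≤m*n; +-identityʳ; +-monoˡ-≤; +-monoʳ-≤; +-cancelˡ-≤
          ; [m+n]∸[m+o]≡n∸o)

  open NatSums

  sumOverMultiples : (ℕ → ℕ) → ℕ → ℕ → ℕ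
  sumOverMultiples f w t = sumBelow (suc t) λ m → if m * w ≤ᵇ t then f (t ∸ m * w) else 0

  countMultisets-∷ : ∀ w ws t → countMultisets (w ∷ ws) t ≡ sumOverMultiples (countMultisets ws) w t
  countMultisets-∷ w ws t = sum-map-applyUpTo _ id (suc t)

  sumOverMultiples-< : ∀ f w t → t < w → sumOverMultiples f w t ≡ f t
  sumOverMultiples-< f w t t<w = trans (cong (f t +_) (sumBelow-extend later {b = t} z≤n λ m _ → if-≤ᵇ-false (too-big m)))
                                       (+-identityʳ (f t))
    where
    later : ℕ → ℕ
    later m = if suc m * w ≤ᵇ t then f (t ∸ suc m * w) else 0
    too-big : ∀ m → suc m * w ≰ t
    too-big m m+1w≤t = <⇒≱ t<w (≤-trans (m≤m+n w (m * w)) m+1w≤t)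

  sumOverMultiples-+ : ∀ f w u .{{_ : NonZero w}} →
                       sumOverMultiples f w (w + u) ≡ f (w + u) + sumOverMultiples f w u
  sumOverMultiples-+ f w u = cong (f (w + u) +_) (begin
    sumBelow (w + u) (λ m → if w + m * w ≤ᵇ w + u then f ((w + u) ∸ (w + m * w)) else 0)
      ≡⟨ sumBelow-cong (w + u) shifted ⟩
    sumBelow (w + u) term
      ≡⟨ sumBelow-extend term (+-monoˡ-≤ u (>-nonZero⁻¹ w)) vanish ⟩
    sumBelow (suc u) term ∎)
    where
    open ≡-Reasoning
    term : ℕ → ℕ
    term m = if m * w ≤ᵇ u then f (u ∸ m * w) else 0
    shifted : ∀ m → (if w + m * w ≤ᵇ w + u then f ((w + u) ∸ (w + m * w)) else 0) ≡ term m
    shifted m with m * w ≤? u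
    ... | yes mw≤u = trans (if-≤ᵇ-true (+-monoʳ-≤ w mw≤u))
                           (trans (cong f ([m+n]∸[m+o]≡n∸o w u (m * w))) (sym (if-≤ᵇ-true mw≤u)))
    ... | no  mw≰u = trans (if-≤ᵇ-false (mw≰u ∘ +-cancelˡ-≤ w (m * w) u)) (sym (if-≤ᵇ-false mw≰u))
    vanish : ∀ m → suc u ≤ m → term m ≡ 0
    vanish m u<m = if-≤ᵇ-false λ mw≤u → <⇒≱ u<m (≤-trans (m≤m*n m w) mw≤u)

module MultisetSeries where

  open PowerSeries
  open MultisetCounting
  open Mod3 using (reduce; reduce-+)
  open import Data.Nat.Properties using (m+[n∸m]≡n; ≰⇒>)
  open import Data.List using (_++_; replicate; concatMap)
  open import Data.List.Relation.Unary.All using (All; []; _∷_)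
  open import Data.List.Relation.Unary.All.Properties using (concat⁺; map⁺; applyUpTo⁺₂; replicate⁺)
  open Solver using (solve; _:+_; _:*_; _:-_; _:=_; con)

  multisetSeries : List ℕ → Series
  multisetSeries ws t = reduce (countMultisets ws t)

  eulerProduct : List ℕ → Series
  eulerProduct []       = 1ₛ
  eulerProduct (w ∷ ws) = 1-q^ w *ₛ eulerProduct ws

  multisetSeries-[] : multisetSeries [] ≐ 1ₛ
  multisetSeries-[] zero    = refl
  multisetSeries-[] (suc t) = refl

  -- A multiset either avoids the head kind, or removing one copy of it leaves one of size t ∸ w.
  multisetSeries-∷ : ∀ w ws .{{_ : NonZero w}} →
                     multisetSeries (w ∷ ws) ≐ multisetSeries ws +ₛ shiftBy w (multisetSeries (w ∷ ws))
  multisetSeries-∷ w ws t with w ≤? t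
  ... | yes w≤t = subst (λ t → C t ≡ (C′ +ₛ shiftBy w C) t) (m+[n∸m]≡n w≤t) (beyond (t ∸ w))
    where
    C  = multisetSeries (w ∷ ws)
    C′ = multisetSeries ws
    beyond : ∀ u → C (w + u) ≡ C′ (w + u) +₃ shiftBy w C (w + u)
    beyond u = begin
      reduce (countMultisets (w ∷ ws) (w + u))
        ≡⟨ cong reduce (trans (countMultisets-∷ w ws (w + u)) (sumOverMultiples-+ (countMultisets ws) w u)) ⟩
      reduce (countMultisets ws (w + u) + sumOverMultiples (countMultisets ws) w u)
        ≡⟨ reduce-+ (countMultisets ws (w + u)) _ ⟩
      C′ (w + u) +₃ reduce (sumOverMultiples (countMultisets ws) w u)
        ≡⟨ cong (λ x → C′ (w + u) +₃ reduce x) (sym (countMultisets-∷ w ws u)) ⟩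
      C′ (w + u) +₃ C u
        ≡⟨ cong (C′ (w + u) +₃_) (sym (shiftBy-+ w C u)) ⟩
      C′ (w + u) +₃ shiftBy w C (w + u) ∎
      where open ≡-Reasoning
  ... | no  w≰t = begin
    reduce (countMultisets (w ∷ ws) t)
      ≡⟨ cong reduce (trans (countMultisets-∷ w ws t) (sumOverMultiples-< (countMultisets ws) w t (≰⇒> w≰t))) ⟩
    multisetSeries ws t
      ≡⟨ sym (ℤ₃R.+-identityʳ _) ⟩
    multisetSeries ws t +₃ [0]
      ≡⟨ cong (multisetSeries ws t +₃_) (sym (shiftBy-< _ (≰⇒> w≰t))) ⟩
    (multisetSeries ws +ₛ shiftBy w (multisetSeries (w ∷ ws))) t ∎
    where open ≡-Reasoning

  multisetSeries-*-1-q^ : ∀ w ws .{{_ : NonZero w}} → multisetSeries (w ∷ ws) *ₛ 1-q^ w ≐ multisetSeries ws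
  multisetSeries-*-1-q^ w ws = begin
    C *ₛ 1-q^ w                          ≈⟨ solve 2 (λ c x → c :* (con [1] :- x) := c :- x :* c) S.refl C (q^ w) ⟩
    C +ₛ -ₛ (q^ w *ₛ C)                  ≈⟨ S.+-congˡ (S.-‿cong (q^-*ₛ w C)) ⟩
    C +ₛ -ₛ shiftBy w C                  ≈⟨ S.+-congʳ (multisetSeries-∷ w ws) ⟩
    C′ +ₛ shiftBy w C +ₛ -ₛ shiftBy w C   ≈⟨ solve 2 (λ c′ x → c′ :+ x :- x := c′) S.refl C′ (shiftBy w C) ⟩
    C′                                   ∎
    where
    open SetoidReasoning S.setoid
    C  = multisetSeries (w ∷ ws)
    C′ = multisetSeries ws

  multisetSeries-*-eulerProduct : ∀ ws → All NonZero ws → multisetSeries ws *ₛ eulerProduct ws ≐ 1ₛ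
  multisetSeries-*-eulerProduct []       []              = S.trans (S.*-congʳ multisetSeries-[]) (S.*-identityˡ 1ₛ)
  multisetSeries-*-eulerProduct (w ∷ ws) (w≢0 ∷ ws≢0) = begin
    multisetSeries (w ∷ ws) *ₛ (1-q^ w *ₛ eulerProduct ws)
      ≈⟨ S.sym (S.*-assoc _ _ _) ⟩
    multisetSeries (w ∷ ws) *ₛ 1-q^ w *ₛ eulerProduct ws
      ≈⟨ S.*-congʳ (multisetSeries-*-1-q^ w ws {{w≢0}}) ⟩
    multisetSeries ws *ₛ eulerProduct ws
      ≈⟨ multisetSeries-*-eulerProduct ws ws≢0 ⟩
    1ₛ ∎
    where open SetoidReasoning S.setoid

  eulerProduct-++ : ∀ xs ys → eulerProduct (xs ++ ys) ≐ eulerProduct xs *ₛ eulerProduct ys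
  eulerProduct-++ []       ys = S.sym (S.*-identityˡ _)
  eulerProduct-++ (x ∷ xs) ys = S.trans (S.*-congˡ (eulerProduct-++ xs ys)) (S.sym (S.*-assoc _ _ _))

  eulerProduct-replicate : ∀ c w → eulerProduct (replicate c w) ≐ (1-q^ w) ^ c
  eulerProduct-replicate zero    w = S.refl
  eulerProduct-replicate (suc c) w = S.*-congˡ (eulerProduct-replicate c w)

  eulerProduct-concatMap-applyUpTo : ∀ (f : ℕ → List ℕ) g n →
    eulerProduct (concatMap f (applyUpTo g n)) ≐ ∏[< n ] (λ i → eulerProduct (f (g i)))
  eulerProduct-concatMap-applyUpTo f g zero    = S.refl
  eulerProduct-concatMap-applyUpTo f g (suc n) = S.trans (eulerProduct-++ (f (g 0)) _)
    (S.trans (S.*-congˡ (eulerProduct-concatMap-applyUpTo f (g ∘ suc) n))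
             (S.sym (∏-head (λ i → eulerProduct (f (g i))) n)))

  colorProduct : ℕ → ℕ → ℕ → Series
  colorProduct r s n = ∏[< n ] (λ i → (1-q^ suc i) ^ colors r s (suc i))

  eulerProduct-kinds : ∀ r s n → eulerProduct (kinds r s n) ≐ colorProduct r s n
  eulerProduct-kinds r s n = S.trans (eulerProduct-concatMap-applyUpTo block id n)
                                     (∏-cong n λ i _ → eulerProduct-replicate (colors r s (suc i)) (suc i))
    where
    block : ℕ → List ℕ
    block i = replicate (colors r s (suc i)) (suc i)

  kinds-nonZero : ∀ r s n → All NonZero (kinds r s n)
  kinds-nonZero r s n = concat⁺ (map⁺ (applyUpTo⁺₂ id n λ i → replicate⁺ (colors r s (suc i)) _))

module GaussianBinomials where

  open PowerSeries
  open Solver using (solve; _:+_; _:*_; _:-_; _:=_; con)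
  open import Data.Nat.Properties
    using ( *-distribˡ-+; 0∸n≡0; m<n⇒m<1+n; m+[n∸m]≡n; m≤n⇒m∸n≡0; ≰⇒>; ≤-pred; n≤1+n; ≤-trans
          ; +-comm)

  infix 9 Q^_ 1-Q^_

  Q^_ : ℕ → Series
  Q^ e = q^ (2 * e)

  1-Q^_ : ℕ → Series
  1-Q^ e = 1-q^ (2 * e)

  Q^-+ : ∀ a b → Q^ a *ₛ Q^ b ≐ Q^ (a + b)
  Q^-+ a b = S.trans (q^-+ (2 * a) (2 * b)) (≐-reflexive (cong q^_ (sym (*-distribˡ-+ 2 a b))))

  1-Q^0 : 1-Q^ 0 ≐ 0ₛ
  1-Q^0 = S.-‿inverseʳ 1ₛ

  [_choose_] : ℕ → ℕ → Series
  [ M     choose zero  ] = 1ₛ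
  [ zero  choose suc m ] = 0ₛ
  [ suc M choose suc m ] = [ M choose m ] +ₛ Q^ (suc m) *ₛ [ M choose suc m ]

  choose-> : ∀ {M m} → M < m → [ M choose m ] ≐ 0ₛ
  choose-> {zero}  {suc m} _          = S.refl
  choose-> {suc M} {suc m} (s≤s M<m) =
    S.trans (S.+-cong (choose-> M<m) (S.trans (S.*-congˡ (choose-> (m<n⇒m<1+n M<m))) (S.zeroʳ _)))
            (S.+-identityˡ 0ₛ)

  1-Q^-*-choose : ∀ e M m → 1-Q^ e *ₛ [ suc M choose suc m ] ≐
                             1-Q^ e *ₛ [ M choose m ] +ₛ Q^ suc m *ₛ (1-Q^ e *ₛ [ M choose suc m ])
  1-Q^-*-choose e M m = solve 4 (λ u a x y → u :* (x :+ a :* y) := u :* x :+ a :* (u :* y))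
                                S.refl (1-Q^ e) (Q^ suc m) [ M choose m ] [ M choose suc m ]

  1-Q^-combine : ∀ a b X → 1-Q^ a *ₛ X +ₛ Q^ a *ₛ (1-Q^ b *ₛ X) ≐ 1-Q^ (a + b) *ₛ X
  1-Q^-combine a b X = S.trans
    (solve 3 (λ x y z → (con [1] :- x) :* z :+ x :* ((con [1] :- y) :* z) := (con [1] :- x :* y) :* z)
           S.refl (Q^ a) (Q^ b) X)
    (S.*-congʳ (S.+-congˡ (S.-‿cong (Q^-+ a b))))

  choose-absorb : ∀ M j → 1-Q^ suc j *ₛ [ M choose suc j ] ≐ 1-Q^ (M ∸ j) *ₛ [ M choose j ]
  choose-absorb zero j = begin
    1-Q^ suc j *ₛ 0ₛ               ≈⟨ S.zeroʳ _ ⟩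
    0ₛ                             ≈⟨ S.sym (S.zeroˡ _) ⟩
    0ₛ *ₛ [ 0 choose j ]           ≈⟨ S.*-congʳ (S.sym (S.trans (≐-reflexive (cong 1-Q^_ (0∸n≡0 j))) 1-Q^0)) ⟩
    1-Q^ (0 ∸ j) *ₛ [ 0 choose j ] ∎
    where open SetoidReasoning S.setoid
  choose-absorb (suc M) zero = begin
    1-Q^ 1 *ₛ [ suc M choose 1 ]                              ≈⟨ 1-Q^-*-choose 1 M 0 ⟩
    1-Q^ 1 *ₛ 1ₛ +ₛ Q^ 1 *ₛ (1-Q^ 1 *ₛ [ M choose 1 ])        ≈⟨ S.+-congˡ (S.*-congˡ (choose-absorb M zero)) ⟩
    1-Q^ 1 *ₛ 1ₛ +ₛ Q^ 1 *ₛ (1-Q^ M *ₛ 1ₛ)                    ≈⟨ 1-Q^-combine 1 M 1ₛ ⟩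
    1-Q^ suc M *ₛ 1ₛ                                          ∎
    where open SetoidReasoning S.setoid
  choose-absorb (suc M) (suc j) with suc j ≤? M
  ... | no  j≮M = S.trans (S.trans (S.*-congˡ (choose-> (s≤s (≰⇒> j≮M)))) (S.zeroʳ _))
                          (S.sym (S.trans (S.*-congʳ 1-Q^[M∸j]≐0) (S.zeroˡ _)))
    where
    1-Q^[M∸j]≐0 : 1-Q^ (M ∸ j) ≐ 0ₛ
    1-Q^[M∸j]≐0 = S.trans (≐-reflexive (cong 1-Q^_ (m≤n⇒m∸n≡0 (≤-pred (≰⇒> j≮M))))) 1-Q^0
  ... | yes j<M = begin
    1-Q^ (2 + j) *ₛ [ suc M choose 2 + j ]
      ≈⟨ 1-Q^-*-choose (2 + j) M (suc j) ⟩
    1-Q^ (2 + j) *ₛ [ M choose suc j ] +ₛ Q^ (2 + j) *ₛ (1-Q^ (2 + j) *ₛ [ M choose 2 + j ])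
      ≈⟨ S.+-congˡ (S.*-congˡ (choose-absorb M (suc j))) ⟩
    1-Q^ (2 + j) *ₛ [ M choose suc j ] +ₛ Q^ (2 + j) *ₛ (1-Q^ (M ∸ suc j) *ₛ [ M choose suc j ])
      ≈⟨ 1-Q^-combine (2 + j) (M ∸ suc j) _ ⟩
    1-Q^ (2 + j + (M ∸ suc j)) *ₛ [ M choose suc j ]
      ≡⟨ cong (λ e → 1-Q^ e *ₛ [ M choose suc j ]) exponents ⟩
    1-Q^ (suc j + (M ∸ j)) *ₛ [ M choose suc j ]
      ≈⟨ S.sym (1-Q^-combine (suc j) (M ∸ j) _) ⟩
    1-Q^ suc j *ₛ [ M choose suc j ] +ₛ Q^ suc j *ₛ (1-Q^ (M ∸ j) *ₛ [ M choose suc j ])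
      ≈⟨ S.+-congʳ (choose-absorb M j) ⟩
    1-Q^ (M ∸ j) *ₛ [ M choose j ] +ₛ Q^ suc j *ₛ (1-Q^ (M ∸ j) *ₛ [ M choose suc j ])
      ≈⟨ S.sym (1-Q^-*-choose (M ∸ j) M j) ⟩
    1-Q^ (M ∸ j) *ₛ [ suc M choose suc j ] ∎
    where
    open SetoidReasoning S.setoid
    exponents : 2 + j + (M ∸ suc j) ≡ suc j + (M ∸ j)
    exponents = trans (cong suc (m+[n∸m]≡n j<M)) (sym (cong suc (m+[n∸m]≡n (≤-trans (n≤1+n j) j<M))))

  choose-pascal′ : ∀ M j → [ suc M choose suc j ] ≐ Q^ (M ∸ j) *ₛ [ M choose j ] +ₛ [ M choose suc j ]
  choose-pascal′ M j = *ₛ-cancelˡ {1-Q^ suc j} refl (begin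
    1-Q^ suc j *ₛ [ suc M choose suc j ]
      ≈⟨ 1-Q^-*-choose (suc j) M j ⟩
    1-Q^ suc j *ₛ [ M choose j ] +ₛ Q^ suc j *ₛ (1-Q^ suc j *ₛ [ M choose suc j ])
      ≈⟨ S.+-congˡ (S.*-congˡ (choose-absorb M j)) ⟩
    1-Q^ suc j *ₛ [ M choose j ] +ₛ Q^ suc j *ₛ (1-Q^ (M ∸ j) *ₛ [ M choose j ])
      ≈⟨ 1-Q^-combine (suc j) (M ∸ j) _ ⟩
    1-Q^ (suc j + (M ∸ j)) *ₛ [ M choose j ]
      ≡⟨ cong (λ e → 1-Q^ e *ₛ [ M choose j ]) (+-comm (suc j) (M ∸ j)) ⟩
    1-Q^ ((M ∸ j) + suc j) *ₛ [ M choose j ]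
      ≈⟨ S.sym (1-Q^-combine (M ∸ j) (suc j) _) ⟩
    1-Q^ (M ∸ j) *ₛ [ M choose j ] +ₛ Q^ (M ∸ j) *ₛ (1-Q^ suc j *ₛ [ M choose j ])
      ≈⟨ S.+-congʳ (S.sym (choose-absorb M j)) ⟩
    1-Q^ suc j *ₛ [ M choose suc j ] +ₛ Q^ (M ∸ j) *ₛ (1-Q^ suc j *ₛ [ M choose j ])
      ≈⟨ solve 4 (λ u b x y → u :* y :+ b :* (u :* x) := u :* (b :* x :+ y))
               S.refl (1-Q^ suc j) (Q^ (M ∸ j)) [ M choose j ] [ M choose suc j ] ⟩
    1-Q^ suc j *ₛ (Q^ (M ∸ j) *ₛ [ M choose j ] +ₛ [ M choose suc j ]) ∎)
    where open SetoidReasoning S.setoid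

  -- The first summand of choose-pascal′, extended by 0 to m = 0.
  pascalTerm : ℕ → ℕ → Series
  pascalTerm M zero    = 0ₛ
  pascalTerm M (suc j) = Q^ (M ∸ j) *ₛ [ M choose j ]

  choose-suc : ∀ M m → [ suc M choose m ] ≐ pascalTerm M m +ₛ [ M choose m ]
  choose-suc M zero    = S.sym (S.+-identityˡ 1ₛ)
  choose-suc M (suc j) = choose-pascal′ M j

  Q^-*-choose : ∀ M m → Q^ suc m *ₛ (Q^ (M ∸ m) *ₛ [ M choose m ]) ≐ Q^ suc M *ₛ [ M choose m ]
  Q^-*-choose M m with m ≤? M
  ... | yes m≤M = S.trans (S.sym (S.*-assoc _ _ _))
                          (S.*-congʳ (S.trans (Q^-+ (suc m) (M ∸ m)) (≐-reflexive (cong (Q^_ ∘ suc) (m+[n∸m]≡n m≤M)))))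
  ... | no  m≰M = S.trans (S.*-congˡ (S.trans (S.*-congˡ M<m) (S.zeroʳ _)))
                          (S.trans (S.zeroʳ _) (S.sym (S.trans (S.*-congˡ M<m) (S.zeroʳ _))))
    where
    M<m : [ M choose m ] ≐ 0ₛ
    M<m = choose-> (≰⇒> m≰M)

  choose-two-steps : ∀ M m → [ 2 + M choose suc m ] ≐
    (1ₛ +ₛ Q^ suc M) *ₛ [ M choose m ] +ₛ pascalTerm M m +ₛ Q^ suc m *ₛ [ M choose suc m ]
  choose-two-steps M m = begin
    [ suc M choose m ] +ₛ Q^ suc m *ₛ [ suc M choose suc m ]
      ≈⟨ S.+-cong (choose-suc M m) (S.*-congˡ (choose-pascal′ M m)) ⟩
    (pascalTerm M m +ₛ [ M choose m ]) +ₛ Q^ suc m *ₛ (Q^ (M ∸ m) *ₛ [ M choose m ] +ₛ [ M choose suc m ])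
      ≈⟨ S.+-congˡ (S.distribˡ _ _ _) ⟩
    (pascalTerm M m +ₛ [ M choose m ]) +ₛ (Q^ suc m *ₛ (Q^ (M ∸ m) *ₛ [ M choose m ]) +ₛ Q^ suc m *ₛ [ M choose suc m ])
      ≈⟨ S.+-congˡ {pascalTerm M m +ₛ [ M choose m ]} (S.+-congʳ {Q^ suc m *ₛ [ M choose suc m ]} (Q^-*-choose M m)) ⟩
    (pascalTerm M m +ₛ [ M choose m ]) +ₛ (Q^ suc M *ₛ [ M choose m ] +ₛ Q^ suc m *ₛ [ M choose suc m ])
      ≈⟨ solve 5 (λ t x c a y → (t :+ x) :+ (c :* x :+ a :* y) := (con [1] :+ c) :* x :+ t :+ a :* y)
               S.refl (pascalTerm M m) [ M choose m ] (Q^ suc M) (Q^ suc m) [ M choose suc m ] ⟩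
    (1ₛ +ₛ Q^ suc M) *ₛ [ M choose m ] +ₛ pascalTerm M m +ₛ Q^ suc m *ₛ [ M choose suc m ] ∎
    where open SetoidReasoning S.setoid

  choose-*-∏ : ∀ M m → [ M choose m ] *ₛ ∏[< m ] (λ i → 1-Q^ suc i) ≐ ∏[< m ] (λ i → 1-Q^ (M ∸ i))
  choose-*-∏ M zero    = S.*-identityˡ 1ₛ
  choose-*-∏ M (suc j) = begin
    [ M choose suc j ] *ₛ (∏[< j ] (λ i → 1-Q^ suc i) *ₛ 1-Q^ suc j)
      ≈⟨ solve 3 (λ c p e → c :* (p :* e) := p :* (e :* c)) S.refl [ M choose suc j ] _ (1-Q^ suc j) ⟩
    ∏[< j ] (λ i → 1-Q^ suc i) *ₛ (1-Q^ suc j *ₛ [ M choose suc j ])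
      ≈⟨ S.*-congˡ (choose-absorb M j) ⟩
    ∏[< j ] (λ i → 1-Q^ suc i) *ₛ (1-Q^ (M ∸ j) *ₛ [ M choose j ])
      ≈⟨ solve 3 (λ p e c → p :* (e :* c) := (c :* p) :* e) S.refl _ (1-Q^ (M ∸ j)) [ M choose j ] ⟩
    [ M choose j ] *ₛ ∏[< j ] (λ i → 1-Q^ suc i) *ₛ 1-Q^ (M ∸ j)
      ≈⟨ S.*-congʳ (choose-*-∏ M j) ⟩
    ∏[< suc j ] (λ i → 1-Q^ (M ∸ i)) ∎
    where open SetoidReasoning S.setoid

module SquaredDistance where

  open import Data.Nat using (∣_-_∣)
  open import Data.Nat.Properties
    using ( ≤-total; ≤-trans; m+[n∸m]≡n; ∣m-m+n∣≡n; ∣-∣-comm; +-comm; *-comm; +-assoc; +-cancelʳ-≡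
          ; m≤n+∣m-n∣; m≤n+∣n-m∣; +-monoʳ-≤; m≤m*n)
  open import Data.Nat.Solver using (module +-*-Solver)
  open +-*-Solver using (solve; _:+_; _:*_; _:=_; con)
  open ≡-Reasoning

  sqDist : ℕ → ℕ → ℕ
  sqDist m n = ∣ m - n ∣ * ∣ m - n ∣

  private
    sqDist-+-2mn-≤ : ∀ {m n} → m ≤ n → sqDist m n + 2 * (m * n) ≡ m * m + n * n
    sqDist-+-2mn-≤ {m} {n} m≤n = subst (λ n → sqDist m n + 2 * (m * n) ≡ m * m + n * n) (m+[n∸m]≡n m≤n) (step (n ∸ m))
      where
      step : ∀ k → sqDist m (m + k) + 2 * (m * (m + k)) ≡ m * m + (m + k) * (m + k)
      step k = begin
        sqDist m (m + k) + 2 * (m * (m + k)) ≡⟨ cong (λ d → d * d + 2 * (m * (m + k))) (∣m-m+n∣≡n m k) ⟩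
        k * k + 2 * (m * (m + k))            ≡⟨ solve 2 (λ m k → k :* k :+ con 2 :* (m :* (m :+ k))
                                                          := m :* m :+ (m :+ k) :* (m :+ k)) refl m k ⟩
        m * m + (m + k) * (m + k)            ∎

  sqDist-+-2mn : ∀ m n → sqDist m n + 2 * (m * n) ≡ m * m + n * n
  sqDist-+-2mn m n with ≤-total m n
  ... | inj₁ m≤n = sqDist-+-2mn-≤ m≤n
  ... | inj₂ n≤m = begin
    sqDist m n + 2 * (m * n) ≡⟨ cong₂ (λ d p → d * d + 2 * p) (∣-∣-comm m n) (*-comm m n) ⟩
    sqDist n m + 2 * (n * m) ≡⟨ sqDist-+-2mn-≤ n≤m ⟩
    n * n + m * m            ≡⟨ +-comm (n * n) (m * m) ⟩
    m * m + n * n            ∎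

  sqDist-≤-bounds : ∀ {m n D} → sqDist m n ≤ D → m ≤ n + D × n ≤ m + D
  sqDist-≤-bounds {m} {n} d²≤D =
    ≤-trans (m≤n+∣m-n∣ m n) (+-monoʳ-≤ n d≤D) , ≤-trans (m≤n+∣n-m∣ n m) (+-monoʳ-≤ m d≤D)
    where
    d≤d² : ∀ d → d ≤ d * d
    d≤d² zero    = z≤n
    d≤d² (suc d) = m≤m*n (suc d) (suc d)
    d≤D : ∣ m - n ∣ ≤ _
    d≤D = ≤-trans (d≤d² ∣ m - n ∣) d²≤D

  sqDist-0-suc : ∀ n → sqDist 0 (suc n) ≡ suc (2 * n) + sqDist 0 n
  sqDist-0-suc n = solve 1 (λ n → (con 1 :+ n) :* (con 1 :+ n) := (con 1 :+ con 2 :* n) :+ n :* n) refl n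

  sqDist-suc : ∀ m n → sqDist m n + 2 * suc m ≡ suc (2 * n) + sqDist (suc m) n
  sqDist-suc m n = +-cancelʳ-≡ (2 * (suc m * n)) _ _ (begin
    sqDist m n + 2 * suc m + 2 * (suc m * n)
      ≡⟨ solve 3 (λ d m n → d :+ con 2 :* (con 1 :+ m) :+ con 2 :* ((con 1 :+ m) :* n)
                         := (d :+ con 2 :* (m :* n)) :+ (con 2 :* (con 1 :+ m) :+ con 2 :* n)) refl (sqDist m n) m n ⟩
    (sqDist m n + 2 * (m * n)) + (2 * suc m + 2 * n)
      ≡⟨ cong (_+ (2 * suc m + 2 * n)) (sqDist-+-2mn m n) ⟩
    (m * m + n * n) + (2 * suc m + 2 * n)
      ≡⟨ solve 2 (λ m n → (m :* m :+ n :* n) :+ (con 2 :* (con 1 :+ m) :+ con 2 :* n)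
                       := (con 1 :+ con 2 :* n) :+ ((con 1 :+ m) :* (con 1 :+ m) :+ n :* n)) refl m n ⟩
    suc (2 * n) + (suc m * suc m + n * n)
      ≡⟨ cong (suc (2 * n) +_) (sym (sqDist-+-2mn (suc m) n)) ⟩
    suc (2 * n) + (sqDist (suc m) n + 2 * (suc m * n))
      ≡⟨ sym (+-assoc (suc (2 * n)) _ _) ⟩
    suc (2 * n) + sqDist (suc m) n + 2 * (suc m * n) ∎)

  sqDist-suc′ : ∀ j n → j ≤ 2 * n → sqDist (suc j) n + 2 * (2 * n ∸ j) ≡ suc (2 * n) + sqDist j n
  sqDist-suc′ j n j≤2n = +-cancelʳ-≡ (2 * suc j) _ _ (begin
    sqDist (suc j) n + 2 * (2 * n ∸ j) + 2 * suc j
      ≡⟨ solve 3 (λ d r j → d :+ con 2 :* r :+ con 2 :* (con 1 :+ j) := d :+ con 2 :* (con 1 :+ (j :+ r))) refl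
               (sqDist (suc j) n) (2 * n ∸ j) j ⟩
    sqDist (suc j) n + 2 * suc (j + (2 * n ∸ j))
      ≡⟨ cong (λ x → sqDist (suc j) n + 2 * suc x) (m+[n∸m]≡n j≤2n) ⟩
    sqDist (suc j) n + 2 * suc (2 * n)
      ≡⟨ solve 2 (λ d n → d :+ con 2 :* (con 1 :+ con 2 :* n)
                       := (con 1 :+ con 2 :* n) :+ d :+ (con 1 :+ con 2 :* n)) refl (sqDist (suc j) n) n ⟩
    suc (2 * n) + sqDist (suc j) n + suc (2 * n)
      ≡⟨ cong (_+ suc (2 * n)) (sym (sqDist-suc j n)) ⟩
    sqDist j n + 2 * suc j + suc (2 * n)
      ≡⟨ solve 3 (λ d j n → d :+ con 2 :* (con 1 :+ j) :+ (con 1 :+ con 2 :* n)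
                         := (con 1 :+ con 2 :* n) :+ d :+ con 2 :* (con 1 :+ j)) refl (sqDist j n) j n ⟩
    suc (2 * n) + sqDist j n + 2 * suc j ∎)

module FiniteJacobi where

  open PowerSeries
  open GaussianBinomials
  open SquaredDistance using (sqDist; sqDist-0-suc; sqDist-suc; sqDist-suc′)
  open Solver using (solve; _:+_; _:*_; _:-_; :-_; _:=_; con)
  open import Data.Nat.Properties using (+-suc; *-suc; +-identityʳ; ≰⇒>; n≤1+n; m≤n+m)

  sign : ℕ → ℤ₃
  sign zero    = [1]
  sign (suc k) = -₃ sign k

  ±[_] : ℕ → Series
  ±[ k ] = const (sign k)

  ±-suc : ∀ k → ±[ suc k ] ≐ -ₛ ±[ k ]
  ±-suc k zero    = refl
  ±-suc k (suc n) = refl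

  below : (ℕ → Series) → ℕ → Series
  below F zero    = 0ₛ
  below F (suc m) = F m

  ∑-below : ∀ F n → ∑[< suc n ] below F ≐ ∑[< n ] F
  ∑-below F n = S.trans (∑-head (below F) n) (S.+-identityˡ _)

  q^-regroup : ∀ a b c d A → a + b ≡ c + d → q^ a *ₛ (q^ b *ₛ A) ≐ q^ c *ₛ (q^ d *ₛ A)
  q^-regroup a b c d A a+b≡c+d = begin
    q^ a *ₛ (q^ b *ₛ A)   ≈⟨ S.sym (S.*-assoc _ _ _) ⟩
    q^ a *ₛ q^ b *ₛ A     ≈⟨ S.*-congʳ (S.trans (q^-+ a b) (S.trans (≐-reflexive (cong q^_ a+b≡c+d))
                                                                   (S.sym (q^-+ c d)))) ⟩
    q^ c *ₛ q^ d *ₛ A     ≈⟨ S.*-assoc _ _ _ ⟩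
    q^ c *ₛ (q^ d *ₛ A)   ∎
    where open SetoidReasoning S.setoid

  q^-split : ∀ a b c A → a ≡ b + c → q^ a *ₛ A ≐ q^ b *ₛ (q^ c *ₛ A)
  q^-split a b c A a≡b+c =
    S.trans (S.*-congʳ (S.trans (≐-reflexive (cong q^_ a≡b+c)) (S.sym (q^-+ b c)))) (S.*-assoc _ _ _)

  jacobiTerm : ℕ → ℕ → Series
  jacobiTerm N m = q^ (sqDist m N) *ₛ [ 2 * N choose m ]

  jacobiTerm-> : ∀ {N m} → 2 * N < m → jacobiTerm N m ≐ 0ₛ
  jacobiTerm-> 2N<m = S.trans (S.*-congˡ (choose-> 2N<m)) (S.zeroʳ _)

  jacobiTerm-suc-zero : ∀ N → jacobiTerm (suc N) 0 ≐ q^ suc (2 * N) *ₛ jacobiTerm N 0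
  jacobiTerm-suc-zero N = q^-split _ (suc (2 * N)) (sqDist 0 N) 1ₛ (sqDist-0-suc N)

  Q^≐q^² : ∀ e → Q^ e ≐ q^ e *ₛ q^ e
  Q^≐q^² e = S.trans (≐-reflexive (cong (λ x → q^ (e + x)) (+-identityʳ e))) (S.sym (q^-+ e e))

  q^-*-pascalTerm : ∀ N m →
    q^ (sqDist (suc m) (suc N)) *ₛ pascalTerm (2 * N) m ≐ q^ suc (2 * N) *ₛ below (jacobiTerm N) m
  q^-*-pascalTerm N zero    = S.trans (S.zeroʳ _) (S.sym (S.zeroʳ _))
  q^-*-pascalTerm N (suc j) with j ≤? 2 * N
  ... | yes j≤2N = q^-regroup (sqDist (suc j) N) (2 * (2 * N ∸ j)) (suc (2 * N)) (sqDist j N) [ 2 * N choose j ]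
                               (sqDist-suc′ j N j≤2N)
  ... | no  j≰2N = S.trans (vanish _ _) (S.sym (vanish _ _))
    where
    vanish : ∀ x y → x *ₛ (y *ₛ [ 2 * N choose j ]) ≐ 0ₛ
    vanish x y = S.trans (S.*-congˡ (S.trans (S.*-congˡ (choose-> (≰⇒> j≰2N))) (S.zeroʳ y))) (S.zeroʳ x)

  jacobiTerm-suc : ∀ N m → jacobiTerm (suc N) (suc m) ≐
    (1ₛ +ₛ q^ suc (2 * N) *ₛ q^ suc (2 * N)) *ₛ jacobiTerm N m
      +ₛ q^ suc (2 * N) *ₛ below (jacobiTerm N) m
      +ₛ q^ suc (2 * N) *ₛ jacobiTerm N (suc m)
  jacobiTerm-suc N m = begin
    q^ d *ₛ [ 2 * suc N choose suc m ]
      ≈⟨ S.*-congˡ (≐-reflexive (cong [_choose suc m ] (*-suc 2 N))) ⟩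
    q^ d *ₛ [ 2 + 2 * N choose suc m ]
      ≈⟨ S.*-congˡ (choose-two-steps (2 * N) m) ⟩
    q^ d *ₛ ((1ₛ +ₛ Q^ suc (2 * N)) *ₛ B m +ₛ pascalTerm (2 * N) m +ₛ Q^ suc m *ₛ B (suc m))
      ≈⟨ solve 6 (λ x c b t e b′ → x :* ((con [1] :+ c) :* b :+ t :+ e :* b′)
                                  := (con [1] :+ c) :* (x :* b) :+ x :* t :+ x :* (e :* b′))
               S.refl (q^ d) (Q^ suc (2 * N)) (B m) (pascalTerm (2 * N) m) (Q^ suc m) (B (suc m)) ⟩
    (1ₛ +ₛ Q^ suc (2 * N)) *ₛ jacobiTerm N m +ₛ q^ d *ₛ pascalTerm (2 * N) m +ₛ q^ d *ₛ (Q^ suc m *ₛ B (suc m))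
      ≈⟨ S.+-cong (S.+-cong (S.*-congʳ (S.+-congˡ (Q^≐q^² (suc (2 * N))))) (q^-*-pascalTerm N m))
                  (q^-regroup d _ (suc (2 * N)) (sqDist (suc m) N) (B (suc m)) (sqDist-suc m N)) ⟩
    (1ₛ +ₛ q^ suc (2 * N) *ₛ q^ suc (2 * N)) *ₛ jacobiTerm N m
      +ₛ q^ suc (2 * N) *ₛ below (jacobiTerm N) m
      +ₛ q^ suc (2 * N) *ₛ jacobiTerm N (suc m) ∎
    where
    open SetoidReasoning S.setoid
    d = sqDist m N
    B = [_choose_] (2 * N)

  signedTerm : ℕ → ℕ → Series
  signedTerm N m = ±[ N + m ] *ₛ jacobiTerm N m

  -- ±[ N + m ] is the sign (-1)^(m-N).
  jacobiSum : ℕ → Series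
  jacobiSum N = ∑[< suc (2 * N) ] signedTerm N

  ±-+-suc : ∀ N m → ±[ N + suc m ] ≐ -ₛ ±[ N + m ]
  ±-+-suc N m = S.trans (≐-reflexive (cong ±[_] (+-suc N m))) (±-suc (N + m))

  -ₛ-±-+-suc : ∀ N m A → -ₛ (±[ N + suc m ] *ₛ A) ≐ ±[ N + m ] *ₛ A
  -ₛ-±-+-suc N m A = S.trans (S.-‿cong (S.*-congʳ (±-+-suc N m)))
                              (solve 2 (λ s a → :- ((:- s) :* a) := s :* a) S.refl ±[ N + m ] A)

  -ₛ-± : ∀ N m A → -ₛ (±[ N + m ] *ₛ A) ≐ ±[ N + suc m ] *ₛ A
  -ₛ-± N m A = S.trans (solve 2 (λ s a → :- (s :* a) := (:- s) :* a) S.refl ±[ N + m ] A)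
                       (S.*-congʳ (S.sym (±-+-suc N m)))

  signedTerm-suc-zero : ∀ N → signedTerm (suc N) 0 ≐ -ₛ (q^ suc (2 * N) *ₛ signedTerm N 0)
  signedTerm-suc-zero N = S.trans (S.*-cong (±-suc (N + 0)) (jacobiTerm-suc-zero N))
    (solve 3 (λ s p t → (:- s) :* (p :* t) := :- (p :* (s :* t))) S.refl ±[ N + 0 ] (q^ suc (2 * N)) (jacobiTerm N 0))

  signedTerm-suc : ∀ N m → signedTerm (suc N) (suc m) ≐
    (1ₛ +ₛ q^ suc (2 * N) *ₛ q^ suc (2 * N)) *ₛ signedTerm N m
      +ₛ (-ₛ q^ suc (2 * N)) *ₛ (below (signedTerm N) m +ₛ signedTerm N (suc m))
  signedTerm-suc N m = begin
    ±[ suc N + suc m ] *ₛ jacobiTerm (suc N) (suc m)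
      ≈⟨ S.*-cong (S.trans (±-suc (N + suc m)) (S.trans (S.-‿cong (±-+-suc N m)) (-‿involutive _))) (jacobiTerm-suc N m) ⟩
    ±[ N + m ] *ₛ ((1ₛ +ₛ p *ₛ p) *ₛ jacobiTerm N m +ₛ p *ₛ below (jacobiTerm N) m +ₛ p *ₛ jacobiTerm N (suc m))
      ≈⟨ solve 5 (λ s p t t₋ t₊ → s :* ((con [1] :+ p :* p) :* t :+ p :* t₋ :+ p :* t₊)
                                := (con [1] :+ p :* p) :* (s :* t) :+ (:- p) :* (:- (s :* t₋) :+ :- (s :* t₊)))
               S.refl ±[ N + m ] p (jacobiTerm N m) (below (jacobiTerm N) m) (jacobiTerm N (suc m)) ⟩
    (1ₛ +ₛ p *ₛ p) *ₛ signedTerm N m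
      +ₛ (-ₛ p) *ₛ (-ₛ (±[ N + m ] *ₛ below (jacobiTerm N) m) +ₛ -ₛ (±[ N + m ] *ₛ jacobiTerm N (suc m)))
      ≈⟨ S.+-congˡ (S.*-congˡ (S.+-cong (below-signed m) (-ₛ-± N m (jacobiTerm N (suc m))))) ⟩
    (1ₛ +ₛ p *ₛ p) *ₛ signedTerm N m +ₛ (-ₛ p) *ₛ (below (signedTerm N) m +ₛ signedTerm N (suc m)) ∎
    where
    open SetoidReasoning S.setoid
    p = q^ suc (2 * N)
    below-signed : ∀ m → -ₛ (±[ N + m ] *ₛ below (jacobiTerm N) m) ≐ below (signedTerm N) m
    below-signed zero    = S.trans (S.-‿cong (S.zeroʳ _)) (λ _ → refl)
    below-signed (suc j) = -ₛ-±-+-suc N j (jacobiTerm N j)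

  signedTerm-> : ∀ N {m} → 2 * N < m → signedTerm N m ≐ 0ₛ
  signedTerm-> N 2N<m = S.trans (S.*-congˡ (jacobiTerm-> 2N<m)) (S.zeroʳ _)

  ∑-linear : ∀ a b F G n → ∑[< n ] (λ i → a *ₛ F i +ₛ b *ₛ G i) ≐ a *ₛ ∑[< n ] F +ₛ b *ₛ ∑[< n ] G
  ∑-linear a b F G n = S.trans (∑-+ₛ _ _ n) (S.sym (S.+-cong (∑-*ₛˡ a F n) (∑-*ₛˡ b G n)))

  jacobiSum-suc : ∀ N → jacobiSum (suc N) ≐ (1-q^ suc (2 * N)) ^ 2 *ₛ jacobiSum N
  jacobiSum-suc N = begin
    ∑[< suc (2 * suc N) ] signedTerm (suc N)
      ≈⟨ ≐-reflexive (cong (λ L → ∑[< suc L ] signedTerm (suc N)) (*-suc 2 N)) ⟩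
    ∑[< suc L ] signedTerm (suc N)
      ≈⟨ ∑-head (signedTerm (suc N)) L ⟩
    signedTerm (suc N) 0 +ₛ ∑[< L ] (signedTerm (suc N) ∘ suc)
      ≈⟨ S.+-cong (signedTerm-suc-zero N) (∑-cong L λ m _ → signedTerm-suc N m) ⟩
    -ₛ (p *ₛ T 0) +ₛ ∑[< L ] (λ m → 1+p² *ₛ T m +ₛ (-ₛ p) *ₛ (below T m +ₛ T (suc m)))
      ≈⟨ S.+-congˡ { -ₛ (p *ₛ T 0)} (S.trans (∑-linear 1+p² (-ₛ p) T (λ m → below T m +ₛ T (suc m)) L)
                           (S.+-congˡ {1+p² *ₛ ∑[< L ] T} (S.*-congˡ (∑-+ₛ (below T) (T ∘ suc) L)))) ⟩
    -ₛ (p *ₛ T 0) +ₛ (1+p² *ₛ ∑[< L ] T +ₛ (-ₛ p) *ₛ (∑[< L ] below T +ₛ ∑[< L ] (T ∘ suc)))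
      ≈⟨ solve 6 (λ p a t x y z → :- (p :* t) :+ (a :* x :+ (:- p) :* (y :+ z))
                                := a :* x :+ (:- p) :* y :+ (:- p) :* (t :+ z))
               S.refl p 1+p² (T 0) (∑[< L ] T) (∑[< L ] below T) (∑[< L ] (T ∘ suc)) ⟩
    1+p² *ₛ ∑[< L ] T +ₛ (-ₛ p) *ₛ ∑[< L ] below T +ₛ (-ₛ p) *ₛ (T 0 +ₛ ∑[< L ] (T ∘ suc))
      ≈⟨ S.+-cong (S.+-cong (S.*-congˡ (∑-extend T (n≤1+n _) vanish))
                            (S.*-congˡ (∑-below T (suc (2 * N)))))
                  (S.*-congˡ (S.trans (S.sym (∑-head T L)) (∑-extend T (m≤n+m _ 2) vanish))) ⟩
    1+p² *ₛ jacobiSum N +ₛ (-ₛ p) *ₛ jacobiSum N +ₛ (-ₛ p) *ₛ jacobiSum N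
      ≈⟨ solve 2 (λ p s → (con [1] :+ p :* p) :* s :+ (:- p) :* s :+ (:- p) :* s
                        := (con [1] :- p) :* ((con [1] :- p) :* con [1]) :* s) S.refl p (jacobiSum N) ⟩
    (1-q^ suc (2 * N)) ^ 2 *ₛ jacobiSum N ∎
    where
    open SetoidReasoning S.setoid
    L = 2 + 2 * N
    p = q^ suc (2 * N)
    1+p² = 1ₛ +ₛ p *ₛ p
    T = signedTerm N
    vanish : ∀ m → suc (2 * N) ≤ m → T m ≐ 0ₛ
    vanish m = signedTerm-> N

  oddFactors : ℕ → Series
  oddFactors N = ∏[< N ] (λ i → 1-q^ suc (2 * i))

  jacobiSum≐oddFactors² : ∀ N → jacobiSum N ≐ oddFactors N ^ 2
  jacobiSum≐oddFactors² zero    = S.+-identityˡ _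
  jacobiSum≐oddFactors² (suc N) = begin
    jacobiSum (suc N)                           ≈⟨ jacobiSum-suc N ⟩
    (1-q^ suc (2 * N)) ^ 2 *ₛ jacobiSum N        ≈⟨ S.*-congˡ (jacobiSum≐oddFactors² N) ⟩
    (1-q^ suc (2 * N)) ^ 2 *ₛ oddFactors N ^ 2   ≈⟨ S.*-comm _ _ ⟩
    oddFactors N ^ 2 *ₛ (1-q^ suc (2 * N)) ^ 2   ≈⟨ S.sym (^-distrib-* (oddFactors N) _ 2) ⟩
    oddFactors (suc N) ^ 2                      ∎
    where open SetoidReasoning S.setoid

module TruncatedGauss where

  open PowerSeries
  open GaussianBinomials
  open SquaredDistance using (sqDist; sqDist-≤-bounds)
  open FiniteJacobi
  open import Data.Nat.Properties
    using ( ≤-trans; m+[n∸m]≡n; m≤m+n; ≰⇒>; +-monoʳ-≤; +-suc; +-identityʳ; +-cancelʳ-≤; m+n≤o⇒m≤o∸n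
          ; module ≤-Reasoning)
  open import Data.Nat.Solver using (module +-*-Solver)
  open +-*-Solver using (solve; _:+_; _:*_; _:=_; con)

  evenFactors : ℕ → Series
  evenFactors L = ∏[< L ] (λ i → 1-Q^ suc i)

  thetaSum : ℕ → Series
  thetaSum N = ∑[< suc (2 * N) ] (λ m → ±[ N + m ] *ₛ q^ (sqDist m N))

  choose-*-evenFactors-≈1 : ∀ D M L m → m ≤ L →
    (∀ i → i < m → D < 2 * (M ∸ i)) → (∀ i → m ≤ i → D < 2 * suc i) →
    [ M choose m ] *ₛ evenFactors L ≈[ D ] 1ₛ
  choose-*-evenFactors-≈1 D M L m m≤L low high = begin
    [ M choose m ] *ₛ evenFactors L
      ≡⟨ cong (λ L → [ M choose m ] *ₛ evenFactors L) (sym (m+[n∸m]≡n m≤L)) ⟩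
    [ M choose m ] *ₛ evenFactors (m + (L ∸ m))
      ≈⟨ ≐⇒≈ (S.*-congˡ (∏-+ (λ i → 1-Q^ suc i) m (L ∸ m))) ⟩
    [ M choose m ] *ₛ (evenFactors m *ₛ ∏[< L ∸ m ] (λ i → 1-Q^ suc (m + i)))
      ≈⟨ ≐⇒≈ (S.sym (S.*-assoc _ _ _)) ⟩
    [ M choose m ] *ₛ evenFactors m *ₛ ∏[< L ∸ m ] (λ i → 1-Q^ suc (m + i))
      ≈⟨ ≐⇒≈ (S.*-congʳ (choose-*-∏ M m)) ⟩
    ∏[< m ] (λ i → 1-Q^ (M ∸ i)) *ₛ ∏[< L ∸ m ] (λ i → 1-Q^ suc (m + i))
      ≈⟨ *ₛ-cong-≈ (∏-≈1 m λ i i<m → 1-q^-≈1 _ (low i i<m))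
                   (∏-≈1 (L ∸ m) λ i _ → 1-q^-≈1 _ (high (m + i) (m≤m+n m i))) ⟩
    1ₛ *ₛ 1ₛ
      ≈⟨ ≐⇒≈ (S.*-identityˡ 1ₛ) ⟩
    1ₛ ∎
    where open SetoidReasoning (≈-setoid D)

  window-low : ∀ {D m i} → m ≤ 2 * D + D → i < m → D < 2 * (2 * (2 * D) ∸ i)
  window-low {D} {m} {i} m≤3D i<m = ≤-trans (m+n≤o⇒m≤o∸n (suc D) (begin
    suc D + i       ≡⟨ sym (+-suc D i) ⟩
    D + suc i       ≤⟨ +-monoʳ-≤ D (≤-trans i<m m≤3D) ⟩
    D + (2 * D + D) ≡⟨ solve 1 (λ D → D :+ (con 2 :* D :+ D) := con 2 :* (con 2 :* D)) refl D ⟩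
    2 * (2 * D)     ∎)) (m≤m+n _ _)
    where open ≤-Reasoning

  window-high : ∀ {D m i} → 2 * D ≤ m + D → m ≤ i → D < 2 * suc i
  window-high {D} {m} 2D≤m+D m≤i = ≤-trans (s≤s (≤-trans D≤m m≤i)) (m≤m+n _ _)
    where
    D≤m : D ≤ m
    D≤m = +-cancelʳ-≤ D D m (subst (_≤ m + D) (cong (D +_) (+-identityʳ D)) 2D≤m+D)

  gauss-≈ : ∀ D → let N = 2 * D in oddFactors N ^ 2 *ₛ evenFactors (2 * N) ≈[ D ] thetaSum N
  gauss-≈ D = begin
    oddFactors N ^ 2 *ₛ evenFactors (2 * N)
      ≈⟨ ≐⇒≈ (S.trans (S.*-congʳ (S.sym (jacobiSum≐oddFactors² N))) (∑-*ₛʳ (signedTerm N) _ (suc (2 * N)))) ⟩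
    ∑[< suc (2 * N) ] (λ m → signedTerm N m *ₛ evenFactors (2 * N))
      ≈⟨ ∑-cong-≈ (suc (2 * N)) (λ m m≤2N → term m (≤-pred′ m≤2N)) ⟩
    thetaSum N ∎
    where
    open SetoidReasoning (≈-setoid D)
    N = 2 * D
    ≤-pred′ : ∀ {m n} → m < suc n → m ≤ n
    ≤-pred′ (s≤s m≤n) = m≤n
    reassociate : ∀ m → signedTerm N m *ₛ evenFactors (2 * N) ≐
                        ±[ N + m ] *ₛ (q^ (sqDist m N) *ₛ ([ 2 * N choose m ] *ₛ evenFactors (2 * N)))
    reassociate m = S.trans (S.*-assoc _ _ _) (S.*-congˡ (S.*-assoc _ _ _))
    term : ∀ m → m ≤ 2 * N → signedTerm N m *ₛ evenFactors (2 * N) ≈[ D ] ±[ N + m ] *ₛ q^ (sqDist m N)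
    term m m≤2N with sqDist m N ≤? D
    ... | no  d²≰D = ≈.trans (≐⇒≈ (reassociate m)) (≈.trans (*ₛ-cong-≈ ≈.refl (q^-*ₛ-≈0 _ _ (≰⇒> d²≰D)))
                                                   (≈.sym (*ₛ-cong-≈ ≈.refl (q^-≈0 _ (≰⇒> d²≰D)))))
    ... | yes d²≤D = ≈.trans (≐⇒≈ (reassociate m))
      (≈.trans (*ₛ-cong-≈ ≈.refl (*ₛ-cong-≈ ≈.refl (choose-*-evenFactors-≈1 D (2 * N) (2 * N) m m≤2N
                                                   (λ i → window-low (proj₁ bounds)) (λ i → window-high (proj₂ bounds)))))
               (≐⇒≈ (S.*-congˡ (S.*-identityʳ _))))
      where
      bounds = sqDist-≤-bounds d²≤D

module Colors where

  open import Data.Nat using (_≡ᵇ_; _%_)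
  open import Data.Nat.DivMod using ([m+kn]%n≡m%n; m*n%n≡0)
  open import Data.Nat.Properties using (*-comm)

  colors-odd : ∀ r s i → colors r s (suc (2 * i)) ≡ s
  colors-odd r s i = cong (λ x → if x ≡ᵇ 0 then r else s)
                          (trans (cong (λ x → suc x % 2) (*-comm 2 i)) ([m+kn]%n≡m%n 1 i 2))

  colors-even : ∀ r s i → colors r s (2 * suc i) ≡ r
  colors-even r s i = cong (λ x → if x ≡ᵇ 0 then r else s)
                           (trans (cong (_% 2) (*-comm 2 (suc i))) (m*n%n≡0 (suc i) 2))

  colors-3*-+ : ∀ t u a b w → colors (3 * t + a) (3 * u + b) w ≡ 3 * colors t u w + colors a b w
  colors-3*-+ t u a b w with (w % 2) ≡ᵇ 0
  ... | true  = refl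
  ... | false = refl

module Congruence where

  open PowerSeries
  open Residues
  open MultisetSeries
  open GaussianBinomials using (1-Q^_)
  open FiniteJacobi using (±[_]; oddFactors)
  open TruncatedGauss
  open Colors
  open SquaredDistance using (sqDist)
  open Mod3 using (reduce; reduce-*; square≢[2]; reduce≡[0]⇒3∣)
  open Solver using (solve; _:*_; _:=_; con)
  open import Algebra.Properties.Semiring.Exp S.semiring using (^-assocʳ)
  open import Data.Nat using (∣_-_∣)
  open import Data.Nat.Properties using (*-suc; ≤-trans; m≤m+n)

  qPochhammer : ℕ → Series
  qPochhammer n = ∏[< n ] (λ i → 1-q^ suc i)

  pairFactor : ℕ → Series
  pairFactor i = 1-q^ suc (2 * i) *ₛ 1-Q^ suc i

  qPochhammer-pairs : ∀ K → qPochhammer (2 * K) ≐ ∏[< K ] pairFactor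
  qPochhammer-pairs K = S.trans (∏-pairs (λ i → 1-q^ suc i) K)
    (∏-cong K λ i _ → S.*-congˡ (≐-reflexive (cong 1-q^_ (sym (*-suc 2 i)))))

  qPochhammer-cube : ∀ n → qPochhammer n ^ 3 ≐ ∏[< n ] (λ i → 1-q^ (3 * suc i))
  qPochhammer-cube n = S.trans (∏-^ _ 3 n) (∏-cong n λ i _ → 1-q^-cube (suc i))

  1-q^-^-3*-+ : ∀ w c e → (1-q^ w) ^ (3 * c + e) ≐ (1-q^ (3 * w)) ^ c *ₛ (1-q^ w) ^ e
  1-q^-^-3*-+ w c e = S.trans (^-homo-* (1-q^ w) (3 * c) e)
    (S.*-congʳ (S.trans (S.sym (^-assocʳ (1-q^ w) 3 c)) (^-congˡ c (1-q^-cube w))))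

  colorProduct-3*-+ : ∀ t u a b n → colorProduct (3 * t + a) (3 * u + b) n ≐
    ∏[< n ] (λ i → (1-q^ (3 * suc i)) ^ colors t u (suc i)) *ₛ colorProduct a b n
  colorProduct-3*-+ t u a b n = S.trans (∏-cong n λ i _ →
      S.trans (≐-reflexive (cong ((1-q^ suc i) ^_) (colors-3*-+ t u a b (suc i))))
              (1-q^-^-3*-+ (suc i) (colors t u (suc i)) (colors a b (suc i))))
    (∏-*ₛ _ _ n)

  colorProduct-2-1-≈ : ∀ D K → D ≤ 2 * K → colorProduct 2 1 D ≈[ D ] qPochhammer (2 * K) *ₛ evenFactors K
  colorProduct-2-1-≈ D K D≤2K = ≈.sym (begin
    qPochhammer (2 * K) *ₛ evenFactors K
      ≈⟨ ≐⇒≈ (S.*-congʳ (qPochhammer-pairs K)) ⟩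
    ∏[< K ] pairFactor *ₛ evenFactors K
      ≈⟨ ≐⇒≈ (S.sym (∏-*ₛ pairFactor (λ i → 1-Q^ suc i) K)) ⟩
    ∏[< K ] (λ i → pairFactor i *ₛ 1-Q^ suc i)
      ≈⟨ ≐⇒≈ (∏-cong K λ i _ → S.sym (pair i)) ⟩
    ∏[< K ] (λ i → F (2 * i) *ₛ F (suc (2 * i)))
      ≈⟨ ≐⇒≈ (S.sym (∏-pairs F K)) ⟩
    ∏[< 2 * K ] F
      ≈⟨ ∏-extend-≈ F D≤2K (λ i D≤i → ^-≈1 (colors 2 1 (suc i)) (1-q^-≈1 (suc i) (s≤s D≤i))) ⟩
    ∏[< D ] F ∎)
    where
    open SetoidReasoning (≈-setoid D)
    F : ℕ → Series
    F i = (1-q^ suc i) ^ colors 2 1 (suc i)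
    pair : ∀ i → F (2 * i) *ₛ F (suc (2 * i)) ≐ pairFactor i *ₛ 1-Q^ suc i
    pair i = S.trans (S.*-cong (≐-reflexive (cong ((1-q^ suc (2 * i)) ^_) (colors-odd 2 1 i)))
                               (≐-reflexive (trans (cong (λ w → (1-q^ w) ^ colors 2 1 w) (sym (*-suc 2 i)))
                                                   (cong ((1-Q^ suc i) ^_) (colors-even 2 1 i)))))
      (solve 2 (λ o e → (o :* con [1]) :* (e :* (e :* con [1])) := (o :* e) :* e) S.refl (1-q^ suc (2 * i)) (1-Q^ suc i))

  thetaSum-avoids-[2] : ∀ N → SupportedOn (_≢ [2]) (thetaSum N)
  thetaSum-avoids-[2] N = ∑-supportedOn {_≢ [2]} (suc (2 * N)) λ m →
    supportedOn-cong {_≢ [2]} (S.*-comm (q^ (sqDist m N)) ±[ N + m ])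
                     (*ₛ-supportedOn (_≢ [2]) (q^-supportedOn {_≢ [2]} (sqDist m N) (square m)) (InQ³-const _))
    where
    square : ∀ m → reduce (sqDist m N) ≢ [2]
    square m d²≡2 = square≢[2] (reduce ∣ m - N ∣) (trans (sym (reduce-* ∣ m - N ∣ ∣ m - N ∣)) d²≡2)

  oddFactors-extend-≈ : ∀ {D N K} → D ≤ N → N ≤ K → oddFactors K ≈[ D ] oddFactors N
  oddFactors-extend-≈ D≤N N≤K =
    ∏-extend-≈ _ N≤K λ i N≤i → 1-q^-≈1 _ (s≤s (≤-trans (≤-trans D≤N N≤i) (m≤m+n _ _)))

  n≤2*n : ∀ n → n ≤ 2 * n
  n≤2*n n = m≤m+n n (n + 0)

  -- colorProduct 2 1 is (q;q)(q²;q²) up to degree D, and Gauss turns its product with Θ into (q;q)³.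
  colorProduct-2-1-*-thetaSum-≈ : ∀ D → let N = 2 * D; K = 2 * N in
    colorProduct 2 1 D *ₛ thetaSum N ≈[ D ] qPochhammer (2 * K) ^ 3
  colorProduct-2-1-*-thetaSum-≈ D = begin
    colorProduct 2 1 D *ₛ thetaSum N
      ≈⟨ *ₛ-cong-≈ (colorProduct-2-1-≈ D K D≤2K) (≈.sym (gauss-≈ D)) ⟩
    P *ₛ E *ₛ (oddFactors N ^ 2 *ₛ E)
      ≈⟨ *ₛ-cong-≈ ≈.refl (*ₛ-cong-≈ (*ₛ-cong-≈ O≈ (*ₛ-cong-≈ O≈ ≈.refl)) ≈.refl) ⟩
    P *ₛ E *ₛ (oddFactors K ^ 2 *ₛ E)
      ≈⟨ ≐⇒≈ (solve 3 (λ p e o → p :* e :* ((o :* (o :* con [1])) :* e) := p :* ((o :* e) :* ((o :* e) :* con [1])))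
                      S.refl P E (oddFactors K)) ⟩
    P *ₛ (oddFactors K *ₛ E) ^ 2
      ≈⟨ ≐⇒≈ (S.*-congˡ (^-congˡ 2 (S.sym (S.trans (qPochhammer-pairs K) (∏-*ₛ _ _ K))))) ⟩
    P ^ 3 ∎
    where
    open SetoidReasoning (≈-setoid D)
    N = 2 * D
    K = 2 * N
    P = qPochhammer (2 * K)
    E = evenFactors K
    D≤2K : D ≤ 2 * K
    D≤2K = ≤-trans (n≤2*n D) (≤-trans (n≤2*n N) (n≤2*n K))
    O≈ : oddFactors N ≈[ D ] oddFactors K
    O≈ = ≈.sym (oddFactors-extend-≈ (n≤2*n D) (n≤2*n N))

  a-divisible-by-3 : ∀ t u D → reduce D ≡ [2] → 3 ∣ a (3 * t + 2) (3 * u + 1) D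
  a-divisible-by-3 t u D D≡2 =
    reduce≡[0]⇒3∣ _ (coefficient-vanishes D [2] V-q³ V₀ CV≈Θ (thetaSum-avoids-[2] N) D≡2)
    where
    N = 2 * D
    K = 2 * N
    ws = kinds (3 * t + 2) (3 * u + 1) D
    C  = multisetSeries ws
    V₁ = ∏[< D ] (λ i → (1-q^ (3 * suc i)) ^ colors t u (suc i))
    P  = qPochhammer (2 * K)
    Θ  = thetaSum N
    V  = V₁ *ₛ P ^ 3

    V-q³ : InQ³ V
    V-q³ = InQ³-*ₛ (InQ³-∏ D λ i → InQ³-^ (colors t u (suc i)) (InQ³-1-q^3* (suc i)))
                   (supportedOn-cong {_≡ [0]} {∏[< 2 * K ] (λ i → 1-q^ (3 * suc i))} (S.sym (qPochhammer-cube (2 * K)))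
                                     (InQ³-∏ (2 * K) λ i → InQ³-1-q^3* (suc i)))

    V₀ : V 0 ≡ [1]
    V₀ = cong₂ _*₃_ (∏-at0 _ D λ i → ^-at0 _ (colors t u (suc i)) refl) (^-at0 P 3 (∏-at0 _ (2 * K) λ i → refl))

    C*V₁U≐1 : C *ₛ (V₁ *ₛ colorProduct 2 1 D) ≐ 1ₛ
    C*V₁U≐1 = S.trans (S.*-congˡ (S.sym (S.trans (eulerProduct-kinds _ _ D) (colorProduct-3*-+ t u 2 1 D))))
                      (multisetSeries-*-eulerProduct ws (kinds-nonZero _ _ D))

    CV≈Θ : C *ₛ V ≈[ D ] Θ
    CV≈Θ = begin
      C *ₛ (V₁ *ₛ P ^ 3)
        ≈⟨ *ₛ-cong-≈ ≈.refl (*ₛ-cong-≈ ≈.refl (≈.sym (colorProduct-2-1-*-thetaSum-≈ D))) ⟩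
      C *ₛ (V₁ *ₛ (colorProduct 2 1 D *ₛ Θ))
        ≈⟨ ≐⇒≈ (solve 4 (λ c v u θ → c :* (v :* (u :* θ)) := c :* (v :* u) :* θ) S.refl C V₁ (colorProduct 2 1 D) Θ) ⟩
      C *ₛ (V₁ *ₛ colorProduct 2 1 D) *ₛ Θ
        ≈⟨ ≐⇒≈ (S.trans (S.*-congʳ C*V₁U≐1) (S.*-identityˡ Θ)) ⟩
      Θ ∎
      where open SetoidReasoning (≈-setoid D)

theorem1p10 : (n k j : ℕ) → j ≤ k →
    3 ∣ a (3 * (k ∸ j) + 5) (3 * k + 1) (3 * n + 2)
theorem1p10 n k j _ = subst (λ r → 3 ∣ a r (3 * k + 1) (3 * n + 2)) r≡
                            (a-divisible-by-3 (k ∸ j + 1) k (3 * n + 2) (reduce-3*-+ n 2))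
  where
  open Mod3 using (reduce-3*-+)
  open Congruence using (a-divisible-by-3)
  open import Data.Nat.Properties using (*-distribˡ-+; +-assoc)
  r≡ : 3 * (k ∸ j + 1) + 2 ≡ 3 * (k ∸ j) + 5
  r≡ = trans (cong (_+ 2) (*-distribˡ-+ 3 (k ∸ j) 1)) (+-assoc (3 * (k ∸ j)) 3 2)
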